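{- Let $n\geq1$ and $1\leq s\leq n$. The number of $132$-avoiding involutions of length $n$ having exactly $s$ right-to-left maxima is $0$ if $n$ is odd and $s$ is even; $\binom{n-1-s/2}{n/2-1}-\binom{n-1-s/2}{n/2}$ if $n$ and $s$ are both even; and $\binom{n-1-(s-1)/2}{\lfloor n/2\rfloor}$ if $s$ is odd.
   Context: An involution of length $n$ is $\pi\in\mathfrak{S}_n$ with $\pi=\pi^{ -1}$ (one-line notation $\pi_1\cdots\pi_n$); it avoids $132$ if there are no $i<j<k$ with $\pi_i<\pi_k<\pi_j$. The entry $\pi_j$ is a right-to-left maximum if $\pi_j>\pi_i$ for all $i$ with $j<i\leq n$. $\lfloor\cdot\rfloor$ is the floor function and $\binom{a}{b}=0$ if $b<0$ or $b>a$. -}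

module Defs where

open import Data.Nat using (ℕ; zero; suc; _∸_; _/_; _%_)
import Data.Nat.Properties as ℕP
open import Data.Nat.Combinatorics using (_C_)
open import Data.Fin using (Fin; _<_; _>_; _<?_)
open import Data.Fin.Properties using (all?; any?; _≟_)
open import Data.Vec using (Vec; lookup; tabulate; count)
open import Data.Product using (_×_; ∃; _,_)
open import Relation.Binary.PropositionalEquality using (_≡_; _≢_)
open import Relation.Nullary using (¬_; Dec; yes; no)
open import Relation.Nullary.Decidable using (_×-dec_; ¬?)

-- A word of length n over [n] in one-line notation: π = π₁ ⋯ πₙ, πᵢ = lookup π i.
Word : ℕ → Set
Word n = Vec (Fin n) n

-- π is a permutation (injective map [n] → [n], hence bijective).
IsPerm : ∀ {n} → Word n → Set
IsPerm {n} π = ∀ (i j : Fin n) → lookup π i ≡ lookup π j → i ≡ j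

IsInvolution : ∀ {n} → Word n → Set
IsInvolution {n} π = ∀ (i : Fin n) → lookup π (lookup π i) ≡ i

Avoids132 : ∀ {n} → Word n → Set
Avoids132 {n} π = ¬ (∃ λ (i : Fin n) → ∃ λ (j : Fin n) → ∃ λ (k : Fin n) →
  (i < j) × (j < k) × (lookup π i < lookup π k) × (lookup π k < lookup π j))

IsRLMax : ∀ {n} → Word n → Fin n → Set
IsRLMax {n} π j = ∀ (i : Fin n) → j < i → lookup π j > lookup π i

isPerm? : ∀ {n} (π : Word n) → Dec (IsPerm π)
isPerm? π = all? λ i → all? λ j → impl (lookup π i ≟ lookup π j) (i ≟ j)
  where
  impl : ∀ {A B : Set} → Dec A → Dec B → Dec (A → B)
  impl _ (yes b) = yes (λ _ → b)
  impl (no ¬a) (no _) = yes (λ a → Data.Empty.⊥-elim (¬a a))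
    where import Data.Empty
  impl (yes a) (no ¬b) = no (λ f → ¬b (f a))

isInvolution? : ∀ {n} (π : Word n) → Dec (IsInvolution π)
isInvolution? π = all? λ i → lookup π (lookup π i) ≟ i

avoids132? : ∀ {n} (π : Word n) → Dec (Avoids132 π)
avoids132? π = ¬? (any? λ i → any? λ j → any? λ k →
  (i <? j) ×-dec (j <? k) ×-dec (lookup π i <? lookup π k) ×-dec (lookup π k <? lookup π j))

isRLMax? : ∀ {n} (π : Word n) (j : Fin n) → Dec (IsRLMax π j)
isRLMax? π j = all? λ i → impl (j <? i) (lookup π i <? lookup π j)
  where
  impl : ∀ {A B : Set} → Dec A → Dec B → Dec (A → B)
  impl _ (yes b) = yes (λ _ → b)
  impl (no ¬a) (no _) = yes (λ a → Data.Empty.⊥-elim (¬a a))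
    where import Data.Empty
  impl (yes a) (no ¬b) = no (λ f → ¬b (f a))

rlmax : ∀ {n} → Word n → ℕ
rlmax {n} π = count (isRLMax? π) (tabulate (λ j → j))

-- The closed formula of the theorem (the even/even case is a nonnegative
-- ballot-type difference, so truncated subtraction ∸ is exact there).
-- parity test: n is even iff n % 2 ≡ 0
even? : (m : ℕ) → Dec (m % 2 ≡ 0)
even? m = m % 2 ℕP.≟ 0

formula : ℕ → ℕ → ℕ
formula n s with even? s
... | no _ = (n ∸ 1 ∸ (s ∸ 1) / 2) C (n / 2)
... | yes _ with even? n
...   | yes _ = ((n ∸ 1 ∸ s / 2) C (n / 2 ∸ 1)) ∸ ((n ∸ 1 ∸ s / 2) C (n / 2))
...   | no _ = 0

{-# OPTIONS --safe #-}
module Submission where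

-- Sort the 132-avoiding involutions f of [0, m + 2) into three kinds.  If f 0 = m + 1, f is the 2-cycle
-- (0, m + 1) wrapped around a 132-avoiding involution of [0, m) with two fewer right-to-left maxima.  If f
-- fixes m and m + 1, it has exactly one maximum, and dropping m + 1 leaves an involution of [0, m + 1)
-- with one maximum.  Otherwise, with Q = f m and R = m − Q, conjugating f by the rotation that moves
-- position m + 1 to R is a bijection onto the involutions with two more maxima (so at least three).
-- Hence the counts a(n, s) satisfy a(m + 2, 1) = a(m + 1, 1) + a(m + 2, 3) and
-- a(m + 2, s + 2) = a(m, s) + a(m + 2, s + 4); the closed formula satisfies the same recurrences (by
-- Pascal's rule, symmetry and unimodality of binomial coefficients) and the same boundary values.

open import Defs
open import Data.Bool using (Bool; T)
open import Data.Bool.Properties using (T-irrelevant)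
open import Data.Empty using (⊥)
open import Data.Fin using (Fin; toℕ; fromℕ<)
import Data.Fin.Properties as Finₚ
open import Data.Nat using (ℕ; zero; suc; pred; _+_; _∸_; _/_; _%_; _≤_; _<_; z≤n; s≤s; s≤s⁻¹; s<s⁻¹;
  _<?_; _≤?_; _≟_; anyUpTo?; allUpTo?; >-nonZero)
open import Data.Nat.Properties
open import Algebra.Properties.CommutativeSemigroup +-commutativeSemigroup
  using () renaming (interchange to +-interchange; xy∙z≈xz∙y to +-right-comm)
open import Data.Nat.Combinatorics using (_C_; nCk+nC[k+1]≡[n+1]C[k+1]; nCk≡nC[n∸k]; nCn≡1; k>n⇒nCk≡0)
open import Data.Nat.DivMod using (m/n≡1+[m∸n]/n; [m+n]%n≡m%n)
open import Data.Product using (Σ; Σ-syntax; _×_; _,_; proj₁; proj₂; ∃)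
open import Data.Sum using (_⊎_; inj₁; inj₂)
open import Data.Sum.Algebra using (⊎-cong)
open import Data.Vec using (lookup; tabulate)
import Data.Vec as Vec
open import Data.Vec.Properties using (lookup∘tabulate; tabulate∘lookup; tabulate-cong)
open import Function using (_∘_)
open import Function.Bundles using (_↔_; mk↔ₛ′)
open import Function.Properties.Inverse using (↔-refl; ↔-sym; ↔-trans)
open import Relation.Binary.Definitions using (tri<; tri≈; tri>)
open import Relation.Binary.PropositionalEquality using (_≡_; _≢_; refl; sym; trans; cong; cong₂; subst; subst₂; module ≡-Reasoning)
open import Relation.Nullary using (¬_; Dec; yes; no; contradiction)
open import Relation.Nullary.Decidable using (True; False; toWitness; fromWitness; toWitnessFalse; fromWitnessFalse; map′; _×-dec_; _→-dec_)
open import Relation.Unary using (Decidable)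

sumBelow : ℕ → (ℕ → ℕ) → ℕ
sumBelow zero    φ = 0
sumBelow (suc n) φ = sumBelow n φ + φ n

syntax sumBelow n (λ i → e) = ∑[ i < n ] e

module _ {φ ψ : ℕ → ℕ} where

  sum-cong : ∀ n → (∀ i → i < n → φ i ≡ ψ i) → ∑[ i < n ] φ i ≡ ∑[ i < n ] ψ i
  sum-cong zero    φ≗ψ = refl
  sum-cong (suc n) φ≗ψ = cong₂ _+_ (sum-cong n (λ i i<n → φ≗ψ i (m<n⇒m<1+n i<n))) (φ≗ψ n ≤-refl)

  sum-mono-≤ : ∀ n → (∀ i → i < n → φ i ≤ ψ i) → ∑[ i < n ] φ i ≤ ∑[ i < n ] ψ i
  sum-mono-≤ zero    φ≤ψ = z≤n
  sum-mono-≤ (suc n) φ≤ψ = +-mono-≤ (sum-mono-≤ n (λ i i<n → φ≤ψ i (m<n⇒m<1+n i<n))) (φ≤ψ n ≤-refl)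

  sum-+ : ∀ n → ∑[ i < n ] (φ i + ψ i) ≡ ∑[ i < n ] φ i + ∑[ i < n ] ψ i
  sum-+ zero    = refl
  sum-+ (suc n) = trans (cong (_+ (φ n + ψ n)) (sum-+ n)) (+-interchange (∑[ i < n ] φ i) (∑[ i < n ] ψ i) (φ n) (ψ n))

sum-zero : ∀ (φ : ℕ → ℕ) n → (∀ i → i < n → φ i ≡ 0) → ∑[ i < n ] φ i ≡ 0
sum-zero φ n φ≗0 = trans (sum-cong n φ≗0) (sum-0 n)
  where
  sum-0 : ∀ n → ∑[ i < n ] 0 ≡ 0
  sum-0 zero    = refl
  sum-0 (suc n) = trans (+-identityʳ _) (sum-0 n)

sum-const-1 : ∀ n → ∑[ i < n ] 1 ≡ n
sum-const-1 zero    = refl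
sum-const-1 (suc n) = trans (cong (_+ 1) (sum-const-1 n)) (+-comm n 1)

sum-suc : ∀ (φ : ℕ → ℕ) n → ∑[ i < suc n ] φ i ≡ φ 0 + ∑[ i < n ] φ (suc i)
sum-suc φ zero    = +-comm 0 (φ 0)
sum-suc φ (suc n) = trans (cong (_+ φ (suc n)) (sum-suc φ n)) (+-assoc (φ 0) _ _)

χ : ∀ {A : Set} → Dec A → ℕ
χ (yes _) = 1
χ (no _)  = 0

module _ {A : Set} where

  χ≤1 : (a? : Dec A) → χ a? ≤ 1
  χ≤1 (yes _) = s≤s z≤n
  χ≤1 (no _)  = z≤n

  χ-yes : (a? : Dec A) → A → χ a? ≡ 1
  χ-yes (yes _) a = refl
  χ-yes (no ¬a) a = contradiction a ¬a

  χ-no : (a? : Dec A) → ¬ A → χ a? ≡ 0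
  χ-no (yes a) ¬a = contradiction a ¬a
  χ-no (no _)  ¬a = refl

  χ-cong : ∀ {B : Set} (a? : Dec A) (b? : Dec B) → (A → B) → (B → A) → χ a? ≡ χ b?
  χ-cong (yes a) (yes b) f g = refl
  χ-cong (yes a) (no ¬b) f g = contradiction (f a) ¬b
  χ-cong (no ¬a) (yes b) f g = contradiction (g b) ¬a
  χ-cong (no _)  (no _)  f g = refl

δ : ℕ → ℕ → ℕ
δ a i = χ (a ≟ i)

δ-self : ∀ a → δ a a ≡ 1
δ-self a = χ-yes (a ≟ a) refl

δ-other : ∀ {a i} → a ≢ i → δ a i ≡ 0
δ-other {a} {i} = χ-no (a ≟ i)

sum-δ : ∀ a n → a < n → ∑[ i < n ] δ a i ≡ 1
sum-δ a (suc n) a<1+n with m≤n⇒m<n∨m≡n (s≤s⁻¹ a<1+n)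
... | inj₁ a<n  rewrite sum-δ a n a<n | δ-other (<⇒≢ a<n) = refl
... | inj₂ refl rewrite sum-zero (δ a) a (λ i i<a → δ-other (>⇒≢ i<a)) | δ-self a = refl

sum-δ≤1 : ∀ a n → ∑[ i < n ] δ a i ≤ 1
sum-δ≤1 a n with a <? n
... | yes a<n = ≤-reflexive (sum-δ a n a<n)
... | no a≮n  = subst (_≤ 1) (sym (sum-zero (δ a) n λ i i<n → δ-other λ { refl → a≮n i<n })) z≤n

InjectiveOn : (ℕ → ℕ) → ℕ → Set
InjectiveOn f n = ∀ a b → a < n → b < n → f a ≡ f b → a ≡ b

injectiveOn⇒≤ : ∀ {m v} (f : ℕ → ℕ) → (∀ k → k < m → f k < v) → InjectiveOn f m → m ≤ v
injectiveOn⇒≤ {m} {v} f f<v f-inj = Finₚ.injective⇒≤ {f = F} F-injective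
  where
  F : Fin m → Fin v
  F k = fromℕ< (f<v (toℕ k) (Finₚ.toℕ<n k))
  F-injective : ∀ {a b} → F a ≡ F b → a ≡ b
  F-injective {a} {b} Fa≡Fb = Finₚ.toℕ-injective (f-inj _ _ (Finₚ.toℕ<n a) (Finₚ.toℕ<n b)
    (trans (sym (Finₚ.toℕ-fromℕ< _)) (trans (cong toℕ Fa≡Fb) (Finₚ.toℕ-fromℕ< _))))

-- If some y in the window were missed, prepending y to f would inject a + 1 points into a slots.
injectiveOn⇒onto : ∀ {a c} (f : ℕ → ℕ) → (∀ k → k < a → c ≤ f k × f k < c + a) → InjectiveOn f a →
                   ∀ y → c ≤ y → y < c + a → ∃ λ k → k < a × f k ≡ y
injectiveOn⇒onto {a} {c} f f∈ f-inj y c≤y y<c+a with anyUpTo? (λ k → f k ≟ y) a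
... | yes hit = hit
... | no miss = contradiction (injectiveOn⇒≤ g g<a g-injective) (<-irrefl refl)
  where
  g : ℕ → ℕ
  g zero    = y ∸ c
  g (suc k) = f k ∸ c
  window : ∀ {x} → c ≤ x → x < c + a → x ∸ c < a
  window {x} c≤x x<c+a = subst (x ∸ c <_) (m+n∸m≡n c a) (∸-monoˡ-< x<c+a c≤x)
  g<a : ∀ k → k < suc a → g k < a
  g<a zero    _          = window c≤y y<c+a
  g<a (suc k) (s≤s k<a)  = let (c≤fk , fk<c+a) = f∈ k k<a in window c≤fk fk<c+a
  fk≢y : ∀ k → k < a → f k ∸ c ≢ y ∸ c
  fk≢y k k<a eq = miss (k , k<a , ∸-cancelʳ-≡ (f∈ k k<a .proj₁) c≤y eq)
  g-injective : InjectiveOn g (suc a)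
  g-injective zero    zero    _ _ _  = refl
  g-injective zero    (suc k) _ (s≤s k<a) eq = contradiction (sym eq) (fk≢y k k<a)
  g-injective (suc k) zero    (s≤s k<a) _ eq = contradiction eq (fk≢y k k<a)
  g-injective (suc k) (suc l) (s≤s k<a) (s≤s l<a) eq =
    cong suc (f-inj k l k<a l<a (∸-cancelʳ-≡ (f∈ k k<a .proj₁) (f∈ l l<a .proj₁) eq))

MapsInto : (ℕ → ℕ) → ℕ → Set
MapsInto f n = ∀ i → i < n → f i < n

InvolutiveOn : (ℕ → ℕ) → ℕ → Set
InvolutiveOn f n = ∀ i → i < n → f (f i) ≡ i

Avoids132On : (ℕ → ℕ) → ℕ → Set
Avoids132On f n = ∀ i j k → i < j → j < k → k < n → f i < f k → f k < f j → ⊥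


-- Positions and values are 0-based (the paper's π_{i+1} - 1 is f i); values of f at i ≥ n are irrelevant.
record Inv132 (f : ℕ → ℕ) (n : ℕ) : Set where
  constructor mkInv132
  field
    maps-into  : MapsInto f n
    involutive : InvolutiveOn f n
    avoids     : Avoids132On f n

  injective : InjectiveOn f n
  injective a b a<n b<n fa≡fb = trans (sym (involutive a a<n)) (trans (cong f fa≡fb) (involutive b b<n))

  f[k]<f[j]⇒f[k]<f[i] : ∀ {i j k} → i < j → j < k → k < n → f k < f j → f k < f i
  f[k]<f[j]⇒f[k]<f[i] {i} {j} {k} i<j j<k k<n fk<fj with f i <? f k
  ... | yes fi<fk = contradiction fk<fj (avoids i j k i<j j<k k<n fi<fk)
  ... | no fi≮fk  = ≤∧≢⇒< (≮⇒≥ fi≮fk) λ fk≡fi → <⇒≢ (<-trans i<j j<k)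
      (injective i k (<-trans i<j (<-trans j<k k<n)) k<n (sym fk≡fi))

module _ {f n} (I : Inv132 f n) where
  open Inv132 I

  window-swap : ∀ {a c} → a ≤ n → (∀ k → k < a → c ≤ f k × f k < c + a) →
                ∀ y → c ≤ y → y < c + a → f y < a
  window-swap a≤n f∈ y c≤y y<c+a with injectiveOn⇒onto f f∈
    (λ k l k<a l<a → injective k l (<-≤-trans k<a a≤n) (<-≤-trans l<a a≤n)) y c≤y y<c+a
  ... | k , k<a , refl = subst (_< _) (sym (involutive k (<-≤-trans k<a a≤n))) k<a

IsRLMaxOn : (ℕ → ℕ) → ℕ → ℕ → Set
IsRLMaxOn f n j = ∀ i → i < n → j < i → f i < f j

isRLMaxOn? : ∀ f n j → Dec (IsRLMaxOn f n j)
isRLMaxOn? f n j = map′ (λ h i → h {i}) (λ h {i} → h i)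
  (allUpTo? (λ i → (j <? i) →-dec (f i <? f j)) n)

rlmaxOn : (ℕ → ℕ) → ℕ → ℕ
rlmaxOn f n = ∑[ j < n ] χ (isRLMaxOn? f n j)

isRLMaxOn-cong : ∀ {f g n} → (∀ i → i < n → f i ≡ g i) → ∀ j → j < n → IsRLMaxOn f n j → IsRLMaxOn g n j
isRLMaxOn-cong f≗g j j<n max i i<n j<i = subst₂ _<_ (f≗g i i<n) (f≗g j j<n) (max i i<n j<i)

rlmaxOn-cong : ∀ {f g n} → (∀ i → i < n → f i ≡ g i) → rlmaxOn f n ≡ rlmaxOn g n
rlmaxOn-cong {f} {g} {n} f≗g = sum-cong n λ j j<n → χ-cong (isRLMaxOn? f n j) (isRLMaxOn? g n j)
  (isRLMaxOn-cong f≗g j j<n) (isRLMaxOn-cong (λ i i<n → sym (f≗g i i<n)) j j<n)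

rlmaxOn≤n : ∀ f n → rlmaxOn f n ≤ n
rlmaxOn≤n f n = ≤-trans (sum-mono-≤ n (λ j _ → χ≤1 (isRLMaxOn? f n j))) (≤-reflexive (sum-const-1 n))

last-isRLMaxOn : ∀ f L → IsRLMaxOn f (suc L) L
last-isRLMaxOn f L i i<1+L L<i = contradiction (s≤s⁻¹ i<1+L) (<⇒≱ L<i)

1≤rlmaxOn : ∀ f L → 1 ≤ rlmaxOn f (suc L)
1≤rlmaxOn f L rewrite χ-yes (isRLMaxOn? f (suc L) L) (last-isRLMaxOn f L) = m≤n+m 1 _

2≤rlmaxOn : ∀ {f n a b} → a < n → b < n → a ≢ b → IsRLMaxOn f n a → IsRLMaxOn f n b → 2 ≤ rlmaxOn f n
2≤rlmaxOn {f} {n} {a} {b} a<n b<n a≢b a-max b-max = begin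
  2                                 ≡⟨ cong₂ _+_ (sym (sum-δ a n a<n)) (sym (sum-δ b n b<n)) ⟩
  ∑[ i < n ] δ a i + ∑[ i < n ] δ b i ≡⟨ sum-+ n ⟨
  ∑[ i < n ] (δ a i + δ b i)         ≤⟨ sum-mono-≤ n δa+δb≤χ ⟩
  rlmaxOn f n                       ∎
  where
  open ≤-Reasoning
  δa+δb≤χ : ∀ i → i < n → δ a i + δ b i ≤ χ (isRLMaxOn? f n i)
  δa+δb≤χ i _ with a ≟ i | b ≟ i
  ... | yes refl | yes refl = contradiction refl a≢b
  ... | yes refl | no _     rewrite χ-yes (isRLMaxOn? f n i) a-max = ≤-refl
  ... | no _     | yes refl rewrite χ-yes (isRLMaxOn? f n i) b-max = ≤-refl
  ... | no _     | no _     = z≤n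

rlmaxOn≤2 : ∀ {f n} a b → (∀ j → j < n → IsRLMaxOn f n j → j ≡ a ⊎ j ≡ b) → rlmaxOn f n ≤ 2
rlmaxOn≤2 {f} {n} a b only-a-b = begin
  rlmaxOn f n                       ≤⟨ sum-mono-≤ n χ≤δa+δb ⟩
  ∑[ i < n ] (δ a i + δ b i)         ≡⟨ sum-+ n ⟩
  ∑[ i < n ] δ a i + ∑[ i < n ] δ b i ≤⟨ +-mono-≤ (sum-δ≤1 a n) (sum-δ≤1 b n) ⟩
  2                                 ∎
  where
  open ≤-Reasoning
  χ≤δa+δb : ∀ i → i < n → χ (isRLMaxOn? f n i) ≤ δ a i + δ b i
  χ≤δa+δb i i<n with isRLMaxOn? f n i
  ... | no _ = z≤n
  ... | yes max with only-a-b i i<n max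
  ... | inj₁ refl rewrite δ-self i = s≤s z≤n
  ... | inj₂ refl rewrite δ-self i = m≤n+m 1 (δ a i)

module _ {f L} (I : Inv132 f (suc L)) where
  open Inv132 I

  fixed-last⇒rlmaxOn≡1 : f L ≡ L → rlmaxOn f (suc L) ≡ 1
  fixed-last⇒rlmaxOn≡1 fL≡L = cong₂ _+_
    (sum-zero _ L λ j j<L → χ-no (isRLMaxOn? f (suc L) j) (not-max j j<L))
    (χ-yes (isRLMaxOn? f (suc L) L) (last-isRLMaxOn f L))
    where
    not-max : ∀ j → j < L → ¬ IsRLMaxOn f (suc L) j
    not-max j j<L max = <⇒≱ (subst (_< f j) fL≡L (max L ≤-refl j<L))
      (s≤s⁻¹ (maps-into j (m<n⇒m<1+n j<L)))

  moved-last⇒2≤rlmaxOn : f L ≢ L → 2 ≤ rlmaxOn f (suc L)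
  moved-last⇒2≤rlmaxOn fL≢L = 2≤rlmaxOn fL<1+L ≤-refl fL≢L fL-max (last-isRLMaxOn f L)
    where
    fL<1+L = maps-into L ≤-refl
    fL-max : IsRLMaxOn f (suc L) (f L)
    fL-max i i<1+L fL<i = subst (f i <_) (sym (involutive L ≤-refl)) (≤∧≢⇒< (s≤s⁻¹ (maps-into i i<1+L))
      λ fi≡L → >⇒≢ fL<i (injective i (f L) i<1+L fL<1+L (trans fi≡L (sym (involutive L ≤-refl)))))

  rlmaxOn≡1⇒fixed-last : rlmaxOn f (suc L) ≡ 1 → f L ≡ L
  rlmaxOn≡1⇒fixed-last rlmax≡1 with f L ≟ L
  ... | yes fL≡L = fL≡L
  ... | no fL≢L  = contradiction (subst (2 ≤_) rlmax≡1 (moved-last⇒2≤rlmaxOn fL≢L)) λ { (s≤s ()) }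

opaque
  skip : ℕ → ℕ → ℕ
  skip R i with i <? R
  ... | yes _ = i
  ... | no _  = suc i

  skip-below : ∀ {R i} → i < R → skip R i ≡ i
  skip-below {R} {i} i<R with i <? R
  ... | yes _    = refl
  ... | no i≮R   = contradiction i<R i≮R

  skip-above : ∀ {R i} → R ≤ i → skip R i ≡ suc i
  skip-above {R} {i} R≤i with i <? R
  ... | yes i<R = contradiction i<R (≤⇒≯ R≤i)
  ... | no _    = refl

  skip-≢ : ∀ R i → skip R i ≢ R
  skip-≢ R i with i <? R
  ... | yes i<R = <⇒≢ i<R
  ... | no i≮R  = λ 1+i≡R → i≮R (≤-reflexive 1+i≡R)

  ≤skip : ∀ R i → i ≤ skip R i
  ≤skip R i with i <? R
  ... | yes _ = ≤-refl
  ... | no _  = n≤1+n i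

  skip≤ : ∀ R i → skip R i ≤ suc i
  skip≤ R i with i <? R
  ... | yes _ = n≤1+n i
  ... | no _  = ≤-refl

  skip-injective : ∀ R {i j} → skip R i ≡ skip R j → i ≡ j
  skip-injective R {i} {j} eq with i <? R | j <? R
  ... | yes _   | yes _   = eq
  ... | no _    | no _    = suc-injective eq
  ... | yes i<R | no j≮R  = contradiction (m≤n⇒m≤1+n (≮⇒≥ j≮R)) (<⇒≱ (subst (_< R) eq i<R))
  ... | no i≮R  | yes j<R = contradiction (m≤n⇒m≤1+n (≮⇒≥ i≮R)) (<⇒≱ (subst (_< R) (sym eq) j<R))

sum-skip : ∀ (φ : ℕ → ℕ) {R} L → R ≤ L → ∑[ i < suc L ] φ i ≡ ∑[ i < L ] φ (skip R i) + φ R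
sum-skip φ zero    z≤n = refl
sum-skip φ {R} (suc L) R≤1+L with m≤n⇒m<n∨m≡n R≤1+L
... | inj₁ R<1+L rewrite sum-skip φ L (s≤s⁻¹ R<1+L) | skip-above (s≤s⁻¹ R<1+L) =
  +-right-comm (∑[ i < L ] φ (skip R i)) (φ R) (φ (suc L))
... | inj₂ refl = cong (_+ φ (suc L)) (sum-cong (suc L) λ i i<R → cong φ (sym (skip-below i<R)))

data RotView (R L i v : ℕ) : Set where
  below : i < R → v ≡ i → RotView R L i v
  last  : i ≡ L → v ≡ R → RotView R L i v
  above : R ≤ i → i ≢ L → v ≡ suc i → RotView R L i v

data Rot⁻¹View (R L x v : ℕ) : Set where
  below : x < R → v ≡ x → Rot⁻¹View R L x v
  first : x ≡ R → v ≡ L → Rot⁻¹View R L x v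
  above : R < x → v ≡ pred x → Rot⁻¹View R L x v

opaque
  rot : ℕ → ℕ → ℕ → ℕ
  rot R L i with i <? R | i ≟ L
  ... | yes _ | _     = i
  ... | no _  | yes _ = R
  ... | no _  | no _  = suc i

  rot⁻¹ : ℕ → ℕ → ℕ → ℕ
  rot⁻¹ R L x with x <? R | x ≟ R
  ... | yes _ | _     = x
  ... | no _  | yes _ = L
  ... | no _  | no _  = pred x

  rot-view : ∀ R L i → RotView R L i (rot R L i)
  rot-view R L i with i <? R | i ≟ L
  ... | yes i<R | _       = below i<R refl
  ... | no i≮R  | yes i≡L = last i≡L refl
  ... | no i≮R  | no i≢L  = above (≮⇒≥ i≮R) i≢L refl

  rot⁻¹-view : ∀ R L x → Rot⁻¹View R L x (rot⁻¹ R L x)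
  rot⁻¹-view R L x with x <? R | x ≟ R
  ... | yes x<R | _       = below x<R refl
  ... | no x≮R  | yes x≡R = first x≡R refl
  ... | no x≮R  | no x≢R  = above (≤∧≢⇒< (≮⇒≥ x≮R) (x≢R ∘ sym)) refl

module Rotation (R L : ℕ) (R≤L : R ≤ L) where

  ρ = rot R L
  ρ⁻¹ = rot⁻¹ R L

  ρ-below : ∀ {i} → i < R → ρ i ≡ i
  ρ-below {i} i<R with rot-view R L i
  ... | below _ eq      = eq
  ... | last refl _     = contradiction R≤L (<⇒≱ i<R)
  ... | above R≤i _ _   = contradiction R≤i (<⇒≱ i<R)

  ρ-last : ρ L ≡ R
  ρ-last with rot-view R L L
  ... | below L<R _   = contradiction R≤L (<⇒≱ L<R)
  ... | last _ eq     = eq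
  ... | above _ L≢L _ = contradiction refl L≢L

  ρ-above : ∀ {i} → R ≤ i → i ≢ L → ρ i ≡ suc i
  ρ-above {i} R≤i i≢L with rot-view R L i
  ... | below i<R _ = contradiction R≤i (<⇒≱ i<R)
  ... | last i≡L _  = contradiction i≡L i≢L
  ... | above _ _ eq = eq

  ρ⁻¹-below : ∀ {x} → x < R → ρ⁻¹ x ≡ x
  ρ⁻¹-below {x} x<R with rot⁻¹-view R L x
  ... | below _ eq    = eq
  ... | first refl _  = contradiction x<R (<-irrefl refl)
  ... | above R<x _   = contradiction (<-trans x<R R<x) (<-irrefl refl)

  ρ⁻¹-first : ρ⁻¹ R ≡ L
  ρ⁻¹-first with rot⁻¹-view R L R
  ... | below R<R _ = contradiction R<R (<-irrefl refl)
  ... | first _ eq  = eq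
  ... | above R<R _ = contradiction R<R (<-irrefl refl)

  ρ⁻¹-above : ∀ {x} → R < x → ρ⁻¹ x ≡ pred x
  ρ⁻¹-above {x} R<x with rot⁻¹-view R L x
  ... | below x<R _  = contradiction (<-trans x<R R<x) (<-irrefl refl)
  ... | first refl _ = contradiction R<x (<-irrefl refl)
  ... | above _ eq   = eq

  ρ⁻¹∘ρ : ∀ i → ρ⁻¹ (ρ i) ≡ i
  ρ⁻¹∘ρ i with rot-view R L i
  ... | below i<R eq    rewrite eq = ρ⁻¹-below i<R
  ... | last refl eq    rewrite eq = ρ⁻¹-first
  ... | above R≤i _ eq  rewrite eq = ρ⁻¹-above (s≤s R≤i)

  ρ∘ρ⁻¹ : ∀ {x} → x < suc L → ρ (ρ⁻¹ x) ≡ x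
  ρ∘ρ⁻¹ {x} x≤L with rot⁻¹-view R L x
  ... | below x<R eq   rewrite eq = ρ-below x<R
  ... | first refl eq  rewrite eq = ρ-last
  ... | above R<x eq   rewrite eq = ρ∘pred R<x x≤L
    where
    ρ∘pred : ∀ {x} → R < x → x < suc L → ρ (pred x) ≡ x
    ρ∘pred {suc x} (s≤s R≤x) (s≤s x<L) = ρ-above R≤x (<⇒≢ x<L)

  ρ-maps-into : MapsInto ρ (suc L)
  ρ-maps-into i i≤L with rot-view R L i
  ... | below _ eq      rewrite eq = i≤L
  ... | last _ eq       rewrite eq = s≤s R≤L
  ... | above _ i≢L eq  rewrite eq = s≤s (≤∧≢⇒< (s≤s⁻¹ i≤L) i≢L)

  ρ⁻¹-maps-into : MapsInto ρ⁻¹ (suc L)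
  ρ⁻¹-maps-into x x≤L with rot⁻¹-view R L x
  ... | below _ eq rewrite eq = x≤L
  ... | first _ eq rewrite eq = ≤-refl
  ... | above _ eq rewrite eq = ≤-<-trans pred[n]≤n x≤L

  ρ-reflects-< : ∀ {y z} → y ≢ L → z ≢ L → ρ y < ρ z → y < z
  ρ-reflects-< {y} {z} y≢L z≢L ρy<ρz with rot-view R L y | rot-view R L z
  ... | last y≡L _ | _          = contradiction y≡L y≢L
  ... | _          | last z≡L _ = contradiction z≡L z≢L
  ... | below _ e₁      | below _ e₂      rewrite e₁ | e₂ = ρy<ρz
  ... | below y<R _     | above R≤z _ _   = <-≤-trans y<R R≤z
  ... | above R≤y _ e₁  | below z<R e₂    rewrite e₁ | e₂ =
    contradiction (<-trans (<-≤-trans z<R R≤y) (<-trans (n<1+n y) ρy<ρz)) (<-irrefl refl)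
  ... | above _ _ e₁    | above _ _ e₂    rewrite e₁ | e₂ = s<s⁻¹ ρy<ρz

  ρ⁻¹-reflects-< : ∀ {x y} → x ≢ R → y ≢ R → ρ⁻¹ x < ρ⁻¹ y → x < y
  ρ⁻¹-reflects-< {x} {y} x≢R y≢R ρ⁻¹x<ρ⁻¹y with rot⁻¹-view R L x | rot⁻¹-view R L y
  ... | first x≡R _ | _           = contradiction x≡R x≢R
  ... | _           | first y≡R _ = contradiction y≡R y≢R
  ... | below _ e₁   | below _ e₂   rewrite e₁ | e₂ = ρ⁻¹x<ρ⁻¹y
  ... | below x<R _  | above R<y _  = <-trans x<R R<y
  ... | above R<x e₁ | below y<R e₂ rewrite e₁ | e₂ =
    contradiction (<-trans ρ⁻¹x<ρ⁻¹y (<-≤-trans y<R (pred-mono-≤ R<x))) (<-irrefl refl)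
  ... | above _ e₁   | above _ e₂   rewrite e₁ | e₂ = pred-cancel-< ρ⁻¹x<ρ⁻¹y

  ρ<R⇒<R : ∀ {y} → y ≢ L → ρ y < R → y < R
  ρ<R⇒<R {y} y≢L ρy<R with rot-view R L y
  ... | below y<R _     = y<R
  ... | last y≡L _      = contradiction y≡L y≢L
  ... | above R≤y _ eq  rewrite eq = contradiction (<-trans (<-≤-trans ρy<R R≤y) (n<1+n y)) (<-irrefl refl)

  R≤ρ⇒R≤ : ∀ {y} → y ≢ L → R ≤ ρ y → R ≤ y
  R≤ρ⇒R≤ {y} y≢L R≤ρy with rot-view R L y
  ... | below _ eq    rewrite eq = R≤ρy
  ... | last y≡L _    = contradiction y≡L y≢L
  ... | above R≤y _ _ = R≤y

  ≤ρ : ∀ {y} → y ≢ L → y ≤ ρ y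
  ≤ρ {y} y≢L with rot-view R L y
  ... | below _ eq    rewrite eq = ≤-refl
  ... | last y≡L _    = contradiction y≡L y≢L
  ... | above _ _ eq  rewrite eq = n≤1+n y

  sum-ρ : ∀ (φ : ℕ → ℕ) → ∑[ i < suc L ] φ i ≡ ∑[ i < suc L ] φ (ρ i)
  sum-ρ φ = begin
    ∑[ i < suc L ] φ i              ≡⟨ sum-skip φ L R≤L ⟩
    ∑[ i < L ] φ (skip R i) + φ R   ≡⟨ cong₂ _+_ (sum-cong L λ i i<L → cong φ (sym (ρ≡skip i<L))) (cong φ (sym ρ-last)) ⟩
    ∑[ i < suc L ] φ (ρ i)          ∎
    where
    open ≡-Reasoning
    ρ≡skip : ∀ {i} → i < L → ρ i ≡ skip R i
    ρ≡skip {i} i<L with rot-view R L i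
    ... | below i<R eq    = trans eq (sym (skip-below i<R))
    ... | last i≡L _      = contradiction i≡L (<⇒≢ i<L)
    ... | above R≤i _ eq  = trans eq (sym (skip-above R≤i))

module Conjugation {σ τ : ℕ → ℕ} {n : ℕ} (σ-into : MapsInto σ n) (τ-into : MapsInto τ n)
                   (τ∘σ : ∀ i → i < n → τ (σ i) ≡ i) (σ∘τ : ∀ x → x < n → σ (τ x) ≡ x) where

  conj-maps-into : ∀ {f} → MapsInto f n → MapsInto (σ ∘ f ∘ τ) n
  conj-maps-into f-into x x<n = σ-into _ (f-into _ (τ-into x x<n))

  conj-involutive : ∀ {f} → MapsInto f n → InvolutiveOn f n → InvolutiveOn (σ ∘ f ∘ τ) n
  conj-involutive {f} f-into f-inv x x<n = begin
    σ (f (τ (σ (f (τ x))))) ≡⟨ cong (σ ∘ f) (τ∘σ _ (f-into _ τx<n)) ⟩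
    σ (f (f (τ x)))         ≡⟨ cong σ (f-inv _ τx<n) ⟩
    σ (τ x)                 ≡⟨ σ∘τ x x<n ⟩
    x                       ∎
    where
    open ≡-Reasoning
    τx<n = τ-into x x<n

module LastPosition (m : ℕ) {f : ℕ → ℕ} (I : Inv132 f (suc (suc m))) where
  open Inv132 I

  L = suc m
  n = suc L
  P = f L

  m<L : m < L
  m<L = ≤-refl
  L<n : L < n
  L<n = ≤-refl
  m<n : m < n
  m<n = <-trans m<L L<n
  P<n : P < n
  P<n = maps-into L L<n
  fP≡L : f P ≡ L
  fP≡L = involutive L L<n

  f≤L : ∀ {i} → i < n → f i ≤ L
  f≤L i<n = s≤s⁻¹ (maps-into _ i<n)

  f≢L : ∀ {i} → i < n → i ≢ P → f i ≢ L
  f≢L {i} i<n i≢P fi≡L = i≢P (injective i P i<n P<n (trans fi≡L (sym fP≡L)))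

  f<L : ∀ {i} → i < n → i ≢ P → f i < L
  f<L i<n i≢P = ≤∧≢⇒< (f≤L i<n) (f≢L i<n i≢P)

  P≤L : P ≤ L
  P≤L = f≤L L<n

  f-descends-across-P : ∀ {i j} → i < P → P < j → j < n → f j < f i
  f-descends-across-P i<P P<j j<n =
    f[k]<f[j]⇒f[k]<f[i] i<P P<j j<n (subst (f _ <_) (sym fP≡L) (f<L j<n (>⇒≢ P<j)))

-- Since Φ m f (m + 1) = f m, Ψ recomputes the rotation point R = m − f m from the image of Φ.
Φ : ℕ → (ℕ → ℕ) → ℕ → ℕ
Φ m f = rot (m ∸ f m) (suc m) ∘ f ∘ rot⁻¹ (m ∸ f m) (suc m)

Ψ : ℕ → (ℕ → ℕ) → ℕ → ℕ
Ψ m u = rot⁻¹ (m ∸ u (suc m)) (suc m) ∘ u ∘ rot (m ∸ u (suc m)) (suc m)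

module Φ-Properties (m : ℕ) (f : ℕ → ℕ) (I : Inv132 f (suc (suc m)))
                    (f0≢L : f 0 ≢ suc m) (¬fixed-fixed : ¬ (f (suc m) ≡ suc m × f m ≡ m)) where
  open Inv132 I
  open LastPosition m I

  Q = f m

  Q<n : Q < n
  Q<n = maps-into m m<n
  fQ≡m : f Q ≡ m
  fQ≡m = involutive m m<n

  Q<P : Q < P
  Q<P with <-cmp Q P
  ... | tri< Q<P _ _ = Q<P
  ... | tri≈ _ Q≡P _ = contradiction (trans (sym fQ≡m) (trans (cong f Q≡P) fP≡L)) (<⇒≢ m<L)
  ... | tri> _ _ P<Q = contradiction (≤-antisym (f≤L (s≤s z≤n)) (subst (_< f 0) fQ≡m
                         (f-descends-across-P (n≢0⇒n>0 P≢0) P<Q Q<n))) f0≢L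
    where
    P≢0 : P ≢ 0
    P≢0 P≡0 = f0≢L (trans (cong f (sym P≡0)) fP≡L)

  Q<m : Q < m
  Q<m = ≤∧≢⇒< (s≤s⁻¹ (<-≤-trans Q<P P≤L)) λ Q≡m →
    ¬fixed-fixed (≤-antisym P≤L (subst (_< P) Q≡m Q<P) , Q≡m)

  f-descends-across-Q : ∀ {i j} → i < Q → Q < j → j < n → j ≢ P → f j < f i
  f-descends-across-Q {i} {j} i<Q Q<j j<n j≢P = f[k]<f[j]⇒f[k]<f[i] i<Q Q<j j<n (subst (f j <_) (sym fQ≡m) fj<m)
    where
    fj<m : f j < m
    fj<m = ≤∧≢⇒< (s≤s⁻¹ (f<L j<n j≢P)) λ fj≡m → >⇒≢ Q<j (injective j Q j<n Q<n (trans fj≡m (sym fQ≡m)))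

  R = m ∸ Q

  Q+R≡m : Q + R ≡ m
  Q+R≡m = m+[n∸m]≡n (<⇒≤ Q<m)
  R≤m : R ≤ m
  R≤m = m∸n≤m m Q
  R≤L : R ≤ L
  R≤L = m≤n⇒m≤1+n R≤m
  R<L : R < L
  R<L = s≤s R≤m
  R<n : R < n
  R<n = <-trans R<L L<n

  -- pigeonhole: the R positions Q + 1, …, m + 1 other than P carry distinct values below f i
  R≤f[≤Q] : ∀ {i} → i ≤ Q → R ≤ f i
  R≤f[≤Q] {i} i≤Q with m≤n⇒m<n∨m≡n i≤Q
  ... | inj₂ refl = subst (R ≤_) (sym fQ≡m) R≤m
  ... | inj₁ i<Q  = injectiveOn⇒≤ (f ∘ pos) (λ k k<R → f-descends-across-Q i<Q (Q<pos k) (pos<n k<R) (skip-≢ P _))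
                      λ k l k<R l<R eq → +-cancelˡ-≡ (suc Q) k l
                        (skip-injective P (injective (pos k) (pos l) (pos<n k<R) (pos<n l<R) eq))
    where
    pos : ℕ → ℕ
    pos k = skip P (suc Q + k)
    Q<pos : ∀ k → Q < pos k
    Q<pos k = <-≤-trans (s≤s (m≤m+n Q k)) (≤skip P _)
    pos<n : ∀ {k} → k < R → pos k < n
    pos<n {k} k<R = s≤s (≤-trans (skip≤ P _) (s≤s (subst (Q + k <_) Q+R≡m (+-monoʳ-< Q k<R))))

  R+1+Q≡L : R + suc Q ≡ L
  R+1+Q≡L = trans (+-suc R Q) (cong suc (trans (+-comm R Q) Q+R≡m))

  f[≤Q]≤m : ∀ {i} → i ≤ Q → f i ≤ m
  f[≤Q]≤m i≤Q = s≤s⁻¹ (f<L (≤-<-trans i≤Q Q<n) (<⇒≢ (≤-<-trans i≤Q Q<P)))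

  -- f maps [0, Q] onto [R, m], hence (being an involution) [R, m] back onto [0, Q]
  f[R⋯m]≤Q : ∀ {x} → R ≤ x → x ≤ m → f x ≤ Q
  f[R⋯m]≤Q {x} R≤x x≤m = s≤s⁻¹ (window-swap I Q<n
    (λ k k<1+Q → R≤f[≤Q] (s≤s⁻¹ k<1+Q) , subst (f k <_) (sym R+1+Q≡L) (s≤s (f[≤Q]≤m (s≤s⁻¹ k<1+Q))))
    x R≤x (subst (x <_) (sym R+1+Q≡L) (s≤s x≤m)))

  R≤f⇒≤Q : ∀ {x} → x < n → x ≢ P → R ≤ f x → x ≤ Q
  R≤f⇒≤Q {x} x<n x≢P R≤fx = subst (_≤ Q) (involutive x x<n) (f[R⋯m]≤Q R≤fx (s≤s⁻¹ (f<L x<n x≢P)))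

  Q<f[<R] : ∀ {i} → i < n → i < R → Q < f i
  Q<f[<R] {i} i<n i<R = ≰⇒> λ fi≤Q → <⇒≱ i<R (subst (R ≤_) (involutive i i<n) (R≤f[≤Q] fi≤Q))

  f[>Q]<R : ∀ {x} → x < n → x ≢ P → Q < x → f x < R
  f[>Q]<R x<n x≢P Q<x = ≰⇒> λ R≤fx → <⇒≱ Q<x (R≤f⇒≤Q x<n x≢P R≤fx)

  Q<R : Q < R
  Q<R = ≰⇒> λ R≤Q → <⇒≱ Q<m (subst (_≤ Q) fQ≡m (f[R⋯m]≤Q R≤Q (<⇒≤ Q<m)))

  P<L⇒P<R : P < L → P < R
  P<L⇒P<R P<L = ≰⇒> λ R≤P → <⇒≱ (<-trans Q<m m<L) (subst (_≤ Q) fP≡L (f[R⋯m]≤Q R≤P (s≤s⁻¹ P<L)))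

  open Rotation R L R≤L

  φ = Φ m f

  φ-maps-into : MapsInto φ n
  φ-maps-into = conj-maps-into maps-into
    where open Conjugation ρ-maps-into ρ⁻¹-maps-into (λ i _ → ρ⁻¹∘ρ i) (λ x → ρ∘ρ⁻¹)

  φ-involutive : InvolutiveOn φ n
  φ-involutive = conj-involutive maps-into involutive
    where open Conjugation ρ-maps-into ρ⁻¹-maps-into (λ i _ → ρ⁻¹∘ρ i) (λ x → ρ∘ρ⁻¹)

  φ-injective : InjectiveOn φ n
  φ-injective x y x<n y<n φx≡φy = trans (sym (φ-involutive x x<n)) (trans (cong φ φx≡φy) (φ-involutive y y<n))

  φ-below : ∀ {x} → x < R → φ x ≡ ρ (f x)
  φ-below x<R = cong (ρ ∘ f) (ρ⁻¹-below x<R)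

  φ-R : φ R ≡ ρ P
  φ-R = cong (ρ ∘ f) ρ⁻¹-first

  φ-above : ∀ {x} → R < x → x < n → φ x ≡ f (pred x)
  φ-above {x} R<x x<n = trans (cong (ρ ∘ f) (ρ⁻¹-above R<x))
    (ρ-below (≤-<-trans (f[R⋯m]≤Q (pred-mono-≤ R<x) (pred-mono-≤ (s≤s⁻¹ x<n))) Q<R))

  φ-above≤Q : ∀ {x} → R < x → x < n → φ x ≤ Q
  φ-above≤Q R<x x<n = subst (_≤ Q) (sym (φ-above R<x x<n)) (f[R⋯m]≤Q (pred-mono-≤ R<x) (pred-mono-≤ (s≤s⁻¹ x<n)))

  Q<ρ : ∀ {y} → Q < y → Q < ρ y
  Q<ρ {y} Q<y with y ≟ L
  ... | yes refl = subst (Q <_) (sym ρ-last) Q<R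
  ... | no y≢L   = <-≤-trans Q<y (≤ρ y≢L)

  Q<φ-below : ∀ {x} → x < R → Q < φ x
  Q<φ-below x<R = subst (Q <_) (sym (φ-below x<R)) (Q<ρ (Q<f[<R] (<-trans x<R R<n) x<R))

  Q<φR : Q < φ R
  Q<φR = subst (Q <_) (sym φ-R) (Q<ρ Q<P)

  private
    pred-< : ∀ {x y} → R < x → x < y → pred x < pred y
    pred-< {suc x} {suc y} _ (s≤s x<y) = x<y

  no-132-ending-beyond-R : ∀ {a b k} → a < b → b < k → k < n → φ a < φ k → φ k < φ b → R < k → ⊥
  no-132-ending-beyond-R {a} {b} {k} a<b b<k k<n φa<φk φk<φb R<k =
    avoids (pred a) (pred b) (pred k) (pred-< R<a a<b) (pred-< R<b b<k) (≤-<-trans pred[n]≤n k<n)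
      (subst₂ _<_ (φ-above R<a a<n) (φ-above R<k k<n) φa<φk)
      (subst₂ _<_ (φ-above R<k k<n) (φ-above R<b b<n) φk<φb)
    where
    b<n = <-trans b<k k<n
    a<n = <-trans a<b b<n
    φk≤Q = φ-above≤Q R<k k<n
    R<a : R < a
    R<a with <-cmp a R
    ... | tri< a<R _ _  = contradiction (<-trans (Q<φ-below a<R) φa<φk) (≤⇒≯ φk≤Q)
    ... | tri≈ _ refl _ = contradiction (<-trans Q<φR φa<φk) (≤⇒≯ φk≤Q)
    ... | tri> _ _ R<a  = R<a
    R<b = <-trans R<a a<b

  module _ {a b} (a<b : a < b) (b<R : b < R) (φa<φR : φ a < φ R) (φR<φb : φ R < φ b) where
    private
      a<R = <-trans a<b b<R
      b<n = <-trans b<R R<n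
      a<n = <-trans a<b b<n
      ρfa<P : P < L → ρ (f a) < P
      ρfa<P P<L = subst₂ _<_ (φ-below a<R) (trans φ-R (ρ-below (P<L⇒P<R P<L))) φa<φR

    no-132-ending-at-R-if-P≡L : P ≡ L → ⊥
    no-132-ending-at-R-if-P≡L P≡L = contradiction (R≤f[≤Q] (<⇒≤ (<-≤-trans a<b b≤Q))) (<⇒≱ fa<R)
      where
      ρP≡R : ρ P ≡ R
      ρP≡R = trans (cong ρ P≡L) ρ-last
      b≢P : b ≢ P
      b≢P b≡P = <⇒≢ (<-trans b<R R<L) (trans b≡P P≡L)
      b≤Q : b ≤ Q
      b≤Q = R≤f⇒≤Q b<n b≢P (R≤ρ⇒R≤ (f≢L b<n b≢P) (<⇒≤ (subst₂ _<_ (trans φ-R ρP≡R) (φ-below b<R) φR<φb)))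
      fa<R : f a < R
      fa<R with f a ≟ L
      ... | yes fa≡L = contradiction (trans (φ-below a<R) (cong ρ (trans fa≡L (sym P≡L))))
                                     (<⇒≢ (subst (φ a <_) φ-R φa<φR))
      ... | no fa≢L  = ρ<R⇒<R fa≢L (subst₂ _<_ (φ-below a<R) (trans φ-R ρP≡R) φa<φR)

    no-132-ending-at-R-if-P<L : P < L → ⊥
    no-132-ending-at-R-if-P<L P<L with a ≟ P | b ≟ P
    ... | yes refl | _        = contradiction (P<L⇒P<R P<L) (<⇒≯ (subst (_< P) (trans (cong ρ fP≡L) ρ-last) (ρfa<P P<L)))
    ... | no a≢P   | yes refl = contradiction (ρfa<P P<L)
                                  (<⇒≯ (<-≤-trans (f-descends-across-P a<b (<-trans b<R R<L) L<n) (≤ρ (f≢L a<n a≢P))))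
    ... | no a≢P   | no b≢P   = avoids a b L a<b (<-trans b<R R<L) L<n
          (ρ-reflects-< (f≢L a<n a≢P) (<⇒≢ P<L) (subst₂ _<_ (φ-below a<R) φ-R φa<φR))
          (ρ-reflects-< (<⇒≢ P<L) (f≢L b<n b≢P) (subst₂ _<_ φ-R (φ-below b<R) φR<φb))

    no-132-ending-at-R : ⊥
    no-132-ending-at-R with P ≟ L
    ... | yes P≡L = no-132-ending-at-R-if-P≡L P≡L
    ... | no P≢L  = no-132-ending-at-R-if-P<L (≤∧≢⇒< P≤L P≢L)

  module _ {a b k} (a<b : a < b) (b<k : b < k) (k<R : k < R) where
    private
      k<n = <-trans k<R R<n
      b<n = <-trans b<k k<n
      a<n = <-trans a<b b<n
      φa≡ρfa = φ-below (<-trans a<b (<-trans b<k k<R))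
      φb≡ρfb = φ-below (<-trans b<k k<R)
      φk≡ρfk = φ-below k<R

    no-132-ending-before-R : φ a < φ k → φ k < φ b → ⊥
    no-132-ending-before-R φa<φk φk<φb with a ≟ P | b ≟ P | k ≟ P
    ... | yes refl | _ | _ = contradiction (<-trans Q<P (<-trans a<b b<k)) (≤⇒≯ k≤Q)
      where
      k≢P = >⇒≢ (<-trans a<b b<k)
      k≤Q = R≤f⇒≤Q k<n k≢P (R≤ρ⇒R≤ (f≢L k<n k≢P)
              (<⇒≤ (subst₂ _<_ (trans φa≡ρfa (trans (cong ρ fP≡L) ρ-last)) φk≡ρfk φa<φk)))
    ... | no a≢P | yes refl | _ = contradiction (f-descends-across-P a<b b<k k<n)
                                    (<⇒≯ (ρ-reflects-< (f≢L a<n a≢P) (f≢L k<n (>⇒≢ b<k)) (subst₂ _<_ φa≡ρfa φk≡ρfk φa<φk)))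
    ... | no a≢P | no b≢P | yes refl = contradiction (R≤f[≤Q] (<⇒≤ (<-≤-trans a<b b≤Q))) (<⇒≱ fa<R)
      where
      φk≡R = trans φk≡ρfk (trans (cong ρ fP≡L) ρ-last)
      fa<R = ρ<R⇒<R (f≢L a<n a≢P) (subst₂ _<_ φa≡ρfa φk≡R φa<φk)
      b≤Q = R≤f⇒≤Q b<n b≢P (R≤ρ⇒R≤ (f≢L b<n b≢P) (<⇒≤ (subst₂ _<_ φk≡R φb≡ρfb φk<φb)))
    ... | no a≢P | no b≢P | no k≢P = avoids a b k a<b b<k k<n
            (ρ-reflects-< (f≢L a<n a≢P) (f≢L k<n k≢P) (subst₂ _<_ φa≡ρfa φk≡ρfk φa<φk))
            (ρ-reflects-< (f≢L k<n k≢P) (f≢L b<n b≢P) (subst₂ _<_ φk≡ρfk φb≡ρfb φk<φb))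

  φ-avoids : Avoids132On φ n
  φ-avoids a b k a<b b<k k<n φa<φk φk<φb with <-cmp k R
  ... | tri< k<R _ _  = no-132-ending-before-R a<b b<k k<R φa<φk φk<φb
  ... | tri≈ _ refl _ = no-132-ending-at-R a<b b<k φa<φk φk<φb
  ... | tri> _ _ R<k  = no-132-ending-beyond-R a<b b<k k<n φa<φk φk<φb R<k

  φ-Inv132 : Inv132 φ n
  φ-Inv132 = mkInv132 φ-maps-into φ-involutive φ-avoids

  MaxF = IsRLMaxOn f n
  Maxφ = IsRLMaxOn φ n

  φ≤L : ∀ {x} → x < n → φ x ≤ L
  φ≤L x<n = s≤s⁻¹ (φ-maps-into _ x<n)

  ρm≡L : ρ m ≡ L
  ρm≡L = ρ-above R≤m (<⇒≢ m<L)

  φQ≡L : φ Q ≡ L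
  φQ≡L = trans (φ-below Q<R) (trans (cong ρ fQ≡m) ρm≡L)

  R-isRLMax-φ : Maxφ R
  R-isRLMax-φ x x<n R<x = ≤-<-trans (φ-above≤Q R<x x<n) Q<φR

  Q-isRLMax-φ : Maxφ Q
  Q-isRLMax-φ x x<n Q<x = subst (φ x <_) (sym φQ≡L) (≤∧≢⇒< (φ≤L x<n)
    λ φx≡L → >⇒≢ Q<x (φ-injective x Q x<n Q<n (trans φx≡L (sym φQ≡L))))

  ¬m-isRLMax-f : ¬ MaxF m
  ¬m-isRLMax-f max = <⇒≯ Q<P (max L L<n m<L)

  ¬Q-isRLMax-f : ¬ MaxF Q
  ¬Q-isRLMax-f max = <⇒≯ m<L (subst₂ _<_ fP≡L fQ≡m (max P P<n Q<P))

  P-isRLMax-f : MaxF P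
  P-isRLMax-f j j<n P<j = subst (f j <_) (sym fP≡L) (f<L j<n (>⇒≢ P<j))

  P-isRLMax-φ : P < R → Maxφ P
  P-isRLMax-φ P<R x x<n P<x = subst (φ x <_) (sym φP≡R) φx<R
    where
    φP≡R = trans (φ-below P<R) (trans (cong ρ fP≡L) ρ-last)
    φx<R : φ x < R
    φx<R with <-cmp x R
    ... | tri< x<R _ _  = let fx<R = f[>Q]<R x<n (>⇒≢ P<x) (<-trans Q<P P<x)
                          in subst (_< R) (sym (trans (φ-below x<R) (ρ-below fx<R))) fx<R
    ... | tri≈ _ refl _ = subst (_< R) (sym (trans φ-R (ρ-below P<R))) P<R
    ... | tri> _ _ R<x  = ≤-<-trans (φ-above≤Q R<x x<n) Q<R

  module _ {i} (R≤i : R ≤ i) (i<m : i < m) where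

    ¬isRLMax-f-above-R : ¬ MaxF i
    ¬isRLMax-f-above-R max = <⇒≱ (max m m<n i<m) (f[R⋯m]≤Q R≤i (<⇒≤ i<m))

    ¬isRLMax-φ-above-R : ¬ Maxφ (ρ i)
    ¬isRLMax-φ-above-R max = <⇒≱ (subst₂ _<_ (φ-above R<L L<n) (φ-above (s≤s R≤i) (s≤s (s≤s (<⇒≤ i<m))))
      (subst (Maxφ) (ρ-above R≤i (<⇒≢ (<-trans i<m m<L))) max L L<n (s≤s i<m))) (f[R⋯m]≤Q R≤i (<⇒≤ i<m))

  module _ {i} (i<R : i < R) (i<P : i < P) (i≢Q : i ≢ Q) where

    ¬isRLMax-f-below-P : ¬ MaxF i
    ¬isRLMax-f-below-P max = <⇒≱ (subst (_< f i) fP≡L (max P P<n i<P)) (f≤L (<-trans i<R R<n))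

    ¬isRLMax-φ-below-P : ¬ Maxφ i
    ¬isRLMax-φ-below-P max with <-cmp i Q
    ... | tri< i<Q _ _  = <⇒≱ (subst (_< φ i) φQ≡L (max Q Q<n i<Q)) (φ≤L (<-trans i<R R<n))
    ... | tri≈ _ i≡Q _  = i≢Q i≡Q
    ... | tri> _ _ Q<i  = <-asym (subst (_< φ i) φρP≡R (max (ρ P) (ρ-maps-into P P<n) i<ρP)) φi<R
      where
      φρP≡R = trans (cong (ρ ∘ f) (ρ⁻¹∘ρ P)) (trans (cong ρ fP≡L) ρ-last)
      i<ρP : i < ρ P
      i<ρP with P ≟ L
      ... | yes P≡L = subst (i <_) (sym (trans (cong ρ P≡L) ρ-last)) i<R
      ... | no P≢L  = <-≤-trans i<P (≤ρ P≢L)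
      fi<R = f[>Q]<R (<-trans i<R R<n) (<⇒≢ i<P) Q<i
      φi<R = subst (_< R) (sym (trans (φ-below i<R) (ρ-below fi<R))) fi<R

  module _ {i} (P<i : P < i) (i<R : i < R) where
    private
      P<R = <-trans P<i i<R
      f<R : ∀ {x} → x < n → i ≤ x → f x < R
      f<R x<n i≤x = f[>Q]<R x<n (>⇒≢ (<-≤-trans P<i i≤x)) (<-trans Q<P (<-≤-trans P<i i≤x))
      φ≡f-below-R : ∀ {x} → x < n → i ≤ x → x < R → φ x ≡ f x
      φ≡f-below-R x<n i≤x x<R = trans (φ-below x<R) (ρ-below (f<R x<n i≤x))
      φi≡fi = φ≡f-below-R (<-trans i<R R<n) ≤-refl i<R
      φR≡fL : φ R ≡ f L
      φR≡fL = trans φ-R (ρ-below P<R)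

    isRLMax-φ⇒f-between-P-R : Maxφ i → MaxF i
    isRLMax-φ⇒f-between-P-R max j j<n i<j with j ≟ L | j <? R
    ... | yes refl | _       = subst₂ _<_ φR≡fL φi≡fi (max R R<n i<R)
    ... | no j≢L   | yes j<R = subst₂ _<_ (φ≡f-below-R j<n (<⇒≤ i<j) j<R) φi≡fi (max j j<n i<j)
    ... | no j≢L   | no j≮R  = subst₂ _<_ (φ-above (s≤s (≮⇒≥ j≮R)) 1+j<n) φi≡fi
                                  (max (suc j) 1+j<n (<-trans i<j (n<1+n j)))
      where 1+j<n = s≤s (≤∧≢⇒< (s≤s⁻¹ j<n) j≢L)

    isRLMax-f⇒φ-between-P-R : MaxF i → Maxφ i
    isRLMax-f⇒φ-between-P-R max x x<n i<x with <-cmp x R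
    ... | tri< x<R _ _  = subst₂ _<_ (sym (φ≡f-below-R x<n (<⇒≤ i<x) x<R)) (sym φi≡fi) (max x x<n i<x)
    ... | tri≈ _ refl _ = subst₂ _<_ (sym φR≡fL) (sym φi≡fi) (max L L<n (<-trans i<R R<L))
    ... | tri> _ _ R<x  = subst₂ _<_ (sym (φ-above R<x x<n)) (sym φi≡fi)
                            (max (pred x) (≤-<-trans pred[n]≤n x<n) (<-≤-trans i<R (pred-mono-≤ R<x)))

  χφ : ℕ → ℕ
  χφ x = χ (isRLMaxOn? φ n x)

  χf : ℕ → ℕ
  χf i = χ (isRLMaxOn? f n i)

  χφ∘ρ≡χf : ∀ i → i < n → i ≢ L → i ≢ m → i ≢ Q → χφ (ρ i) ≡ χf i
  χφ∘ρ≡χf i i<n i≢L i≢m i≢Q with i <? R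
  ... | no i≮R = trans (χ-no (isRLMaxOn? φ n (ρ i)) (¬isRLMax-φ-above-R R≤i i<m))
                       (sym (χ-no (isRLMaxOn? f n i) (¬isRLMax-f-above-R R≤i i<m)))
    where
    R≤i = ≮⇒≥ i≮R
    i<m = ≤∧≢⇒< (s≤s⁻¹ (≤∧≢⇒< (s≤s⁻¹ i<n) i≢L)) i≢m
  ... | yes i<R rewrite ρ-below i<R with <-cmp i P
  ...   | tri< i<P _ _  = trans (χ-no (isRLMaxOn? φ n i) (¬isRLMax-φ-below-P i<R i<P i≢Q))
                                (sym (χ-no (isRLMaxOn? f n i) (¬isRLMax-f-below-P i<R i<P i≢Q)))
  ...   | tri≈ _ refl _ = trans (χ-yes (isRLMaxOn? φ n P) (P-isRLMax-φ i<R))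
                                (sym (χ-yes (isRLMaxOn? f n P) P-isRLMax-f))
  ...   | tri> _ _ P<i  = χ-cong (isRLMaxOn? φ n i) (isRLMaxOn? f n i)
                                 (isRLMax-φ⇒f-between-P-R P<i i<R) (isRLMax-f⇒φ-between-P-R P<i i<R)

  χφ∘ρ≡χf+δ : ∀ i → i < n → χφ (ρ i) ≡ χf i + (δ Q i + δ m i)
  χφ∘ρ≡χf+δ i i<n with i ≟ L | i ≟ m | i ≟ Q
  ... | yes refl | _ | _ rewrite ρ-last
    | χ-yes (isRLMaxOn? φ n R) R-isRLMax-φ | χ-yes (isRLMaxOn? f n L) (last-isRLMaxOn f L)
    | δ-other (<⇒≢ (<-trans Q<m m<L)) | δ-other (<⇒≢ m<L) = refl
  ... | no _ | yes refl | _ rewrite ρm≡L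
    | χ-yes (isRLMaxOn? φ n L) (last-isRLMaxOn φ L) | χ-no (isRLMaxOn? f n m) ¬m-isRLMax-f
    | δ-other (<⇒≢ Q<m) | δ-self m = refl
  ... | no _ | no _ | yes refl rewrite ρ-below Q<R
    | χ-yes (isRLMaxOn? φ n Q) Q-isRLMax-φ | χ-no (isRLMaxOn? f n Q) ¬Q-isRLMax-f
    | δ-self Q | δ-other (>⇒≢ Q<m) = refl
  ... | no i≢L | no i≢m | no i≢Q rewrite δ-other (i≢Q ∘ sym) | δ-other (i≢m ∘ sym) =
    trans (χφ∘ρ≡χf i i<n i≢L i≢m i≢Q) (sym (+-identityʳ (χf i)))

  φ-rlmax : rlmaxOn φ n ≡ rlmaxOn f n + 2
  φ-rlmax = begin
    rlmaxOn φ n                                  ≡⟨ sum-ρ χφ ⟩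
    ∑[ i < n ] χφ (ρ i)                          ≡⟨ sum-cong n χφ∘ρ≡χf+δ ⟩
    ∑[ i < n ] (χf i + (δ Q i + δ m i))          ≡⟨ sum-+ n ⟩
    rlmaxOn f n + ∑[ i < n ] (δ Q i + δ m i)     ≡⟨ cong (rlmaxOn f n +_) (sum-+ n) ⟩
    rlmaxOn f n + (∑[ i < n ] δ Q i + ∑[ i < n ] δ m i)
                                                 ≡⟨ cong (rlmaxOn f n +_) (cong₂ _+_ (sum-δ Q n Q<n) (sum-δ m n m<n)) ⟩
    rlmaxOn f n + 2                              ∎
    where open ≡-Reasoning

  φ-last : φ L ≡ Q
  φ-last = φ-above R<L L<n

  Ψ∘Φ≗id : ∀ x → Ψ m φ x ≡ f x
  Ψ∘Φ≗id x = begin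
    Ψ m φ x           ≡⟨ cong (λ R′ → rot⁻¹ R′ L (φ (rot R′ L x))) (cong (m ∸_) φ-last) ⟩
    ρ⁻¹ (ρ (f (ρ⁻¹ (ρ x)))) ≡⟨ ρ⁻¹∘ρ (f (ρ⁻¹ (ρ x))) ⟩
    f (ρ⁻¹ (ρ x))     ≡⟨ cong f (ρ⁻¹∘ρ x) ⟩
    f x               ∎
    where open ≡-Reasoning

Φ-cong : ∀ m {f g} → (∀ i → i < suc (suc m) → f i ≡ g i) → ∀ x → x < suc (suc m) → Φ m f x ≡ Φ m g x
Φ-cong m {f} {g} f≗g x x<n rewrite f≗g m (m<n⇒m<1+n ≤-refl) =
  cong (rot R (suc m)) (f≗g _ (Rotation.ρ⁻¹-maps-into R (suc m) (m≤n⇒m≤1+n (m∸n≤m m (g m))) x x<n))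
  where R = m ∸ g m

module Ψ-Properties (m : ℕ) (u : ℕ → ℕ) (I : Inv132 u (suc (suc m))) (3≤rlmax : 3 ≤ rlmaxOn u (suc (suc m))) where
  open Inv132 I
  open LastPosition m I using (L; n; m<L; L<n; m<n)
    renaming (P to Q; P<n to Q<n; fP≡L to uQ≡L; f≤L to u≤L; f<L to u<L; P≤L to Q≤L;
              f-descends-across-P to u-descends-across-Q)

  Q≢L : Q ≢ L
  Q≢L Q≡L = contradiction (subst (3 ≤_) (fixed-last⇒rlmaxOn≡1 I Q≡L) 3≤rlmax) λ { (s≤s ()) }

  Q≤m : Q ≤ m
  Q≤m = s≤s⁻¹ (≤∧≢⇒< Q≤L Q≢L)

  R = m ∸ Q

  Q+R≡m : Q + R ≡ m
  Q+R≡m = m+[n∸m]≡n Q≤m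
  R≤m : R ≤ m
  R≤m = m∸n≤m m Q
  R≤L : R ≤ L
  R≤L = m≤n⇒m≤1+n R≤m
  R<L : R < L
  R<L = s≤s R≤m
  R<n : R < n
  R<n = <-trans R<L L<n
  1+R+Q≡L : suc R + Q ≡ L
  1+R+Q≡L = cong suc (trans (+-comm R Q) Q+R≡m)

  -- pigeonhole: the R + 1 positions Q + 1, …, L carry distinct values below u i
  R<u[<Q] : ∀ {i} → i < Q → R < u i
  R<u[<Q] {i} i<Q = injectiveOn⇒≤ (u ∘ pos) (λ k k<1+R → u-descends-across-Q i<Q (s≤s (m≤m+n Q k)) (pos<n k<1+R))
    λ k l k<1+R l<1+R eq → +-cancelˡ-≡ (suc Q) k l (injective (pos k) (pos l) (pos<n k<1+R) (pos<n l<1+R) eq)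
    where
    pos : ℕ → ℕ
    pos k = suc Q + k
    pos<n : ∀ {k} → k < suc R → pos k < n
    pos<n {k} k≤R = s≤s (s≤s (subst (Q + k ≤_) Q+R≡m (+-monoʳ-≤ Q (s≤s⁻¹ k≤R))))

  u[<Q]≤m : ∀ {i} → i < Q → u i ≤ m
  u[<Q]≤m i<Q = s≤s⁻¹ (u<L (<-trans i<Q Q<n) (<⇒≢ i<Q))

  -- u maps [0, Q) onto (R, m], hence (being an involution) (R, m] back onto [0, Q)
  u[R⋯m]<Q : ∀ {x} → R < x → x ≤ m → u x < Q
  u[R⋯m]<Q {x} R<x x≤m = window-swap I (<⇒≤ Q<n)
    (λ k k<Q → R<u[<Q] k<Q , subst (u k <_) (sym 1+R+Q≡L) (s≤s (u[<Q]≤m k<Q)))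
    x R<x (subst (x <_) (sym 1+R+Q≡L) (s≤s x≤m))

  R<u⇒≤Q : ∀ {x} → x < n → R < u x → x ≤ Q
  R<u⇒≤Q {x} x<n R<ux with u x ≟ L
  ... | yes ux≡L = ≤-reflexive (injective x Q x<n Q<n (trans ux≡L (sym uQ≡L)))
  ... | no ux≢L  = <⇒≤ (subst (_< Q) (involutive x x<n) (u[R⋯m]<Q R<ux (s≤s⁻¹ (≤∧≢⇒< (u≤L x<n) ux≢L))))

  Q≤R : Q ≤ R
  Q≤R = ≮⇒≥ λ R<Q → <⇒≱ (subst (_< Q) uQ≡L (u[R⋯m]<Q R<Q Q≤m)) (m≤n⇒m≤1+n Q≤m)

  -- if Q = R, only Q and L could be right-to-left maxima
  Q<R : Q < R
  Q<R = ≤∧≢⇒< Q≤R λ Q≡R → contradiction (≤-trans 3≤rlmax (rlmaxOn≤2 Q L (only-Q-L Q≡R))) λ { (s≤s (s≤s ())) }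
    where
    only-Q-L : Q ≡ R → ∀ j → j < n → IsRLMaxOn u n j → j ≡ Q ⊎ j ≡ L
    only-Q-L Q≡R j j<n max with <-cmp j Q | j ≟ L
    ... | tri≈ _ j≡Q _ | _        = inj₁ j≡Q
    ... | tri< j<Q _ _ | _        = contradiction (subst (_< u j) uQ≡L (max Q Q<n j<Q)) (≤⇒≯ (u≤L j<n))
    ... | tri> _ _ Q<j | yes j≡L  = inj₂ j≡L
    ... | tri> _ _ Q<j | no j≢L   = contradiction (max L L<n j<L)
                                     (<⇒≯ (u[R⋯m]<Q (subst (_< j) Q≡R Q<j) (s≤s⁻¹ j<L)))
      where j<L = ≤∧≢⇒< (s≤s⁻¹ j<n) j≢L

  Q<u[≤R] : ∀ {x} → x ≤ R → Q < u x
  Q<u[≤R] {x} x≤R with <-cmp (u x) Q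
  ... | tri< ux<Q _ _  = contradiction (subst (R <_) (involutive x x<n) (R<u[<Q] ux<Q)) (≤⇒≯ x≤R)
    where x<n = ≤-<-trans x≤R R<n
  ... | tri≈ _ ux≡Q _  = contradiction (trans (sym (involutive x x<n)) (trans (cong u ux≡Q) uQ≡L)) (<⇒≢ (≤-<-trans x≤R R<L))
    where x<n = ≤-<-trans x≤R R<n
  ... | tri> _ _ Q<ux  = Q<ux

  P = u R

  Q<P : Q < P
  Q<P = Q<u[≤R] ≤-refl
  P≤R : P ≤ R
  P≤R = ≮⇒≥ λ R<P → <⇒≱ Q<R (R<u⇒≤Q R<n R<P)
  P<n : P < n
  P<n = ≤-<-trans P≤R R<n

  u[>R]≤Q : ∀ {x} → R < x → x < n → u x ≤ Q
  u[>R]≤Q {x} R<x x<n with x ≟ L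
  ... | yes refl = ≤-refl
  ... | no x≢L   = <⇒≤ (u[R⋯m]<Q R<x (s≤s⁻¹ (≤∧≢⇒< (s≤s⁻¹ x<n) x≢L)))

  open Rotation R L R≤L

  ψ = Ψ m u

  ψ-maps-into : MapsInto ψ n
  ψ-maps-into = conj-maps-into maps-into
    where open Conjugation ρ⁻¹-maps-into ρ-maps-into (λ x → ρ∘ρ⁻¹) (λ i _ → ρ⁻¹∘ρ i)

  ψ-involutive : InvolutiveOn ψ n
  ψ-involutive = conj-involutive maps-into involutive
    where open Conjugation ρ⁻¹-maps-into ρ-maps-into (λ x → ρ∘ρ⁻¹) (λ i _ → ρ⁻¹∘ρ i)

  ψ-below : ∀ {x} → x < R → ψ x ≡ ρ⁻¹ (u x)
  ψ-below x<R = cong (ρ⁻¹ ∘ u) (ρ-below x<R)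

  ψ-last : ψ L ≡ ρ⁻¹ P
  ψ-last = cong (ρ⁻¹ ∘ u) ρ-last

  ψ-above : ∀ {x} → R ≤ x → x ≢ L → x < n → ψ x ≡ u (suc x)
  ψ-above {x} R≤x x≢L x<n = trans (cong (ρ⁻¹ ∘ u) (ρ-above R≤x x≢L))
    (ρ⁻¹-below (≤-<-trans (u[>R]≤Q (s≤s R≤x) (s≤s (≤∧≢⇒< (s≤s⁻¹ x<n) x≢L))) Q<R))

  ψ-above≤Q : ∀ {x} → R ≤ x → x ≢ L → x < n → ψ x ≤ Q
  ψ-above≤Q R≤x x≢L x<n = subst (_≤ Q) (sym (ψ-above R≤x x≢L x<n))
    (u[>R]≤Q (s≤s R≤x) (s≤s (≤∧≢⇒< (s≤s⁻¹ x<n) x≢L)))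

  Q<ρ⁻¹ : ∀ {y} → Q < y → Q < ρ⁻¹ y
  Q<ρ⁻¹ {y} Q<y with <-cmp y R
  ... | tri< y<R _ _  = subst (Q <_) (sym (ρ⁻¹-below y<R)) Q<y
  ... | tri≈ _ refl _ = subst (Q <_) (sym ρ⁻¹-first) (<-trans Q<R R<L)
  ... | tri> _ _ R<y  = subst (Q <_) (sym (ρ⁻¹-above R<y)) (<-≤-trans Q<R (pred-mono-≤ R<y))

  Q<ψ-below : ∀ {x} → x < R → Q < ψ x
  Q<ψ-below x<R = subst (Q <_) (sym (ψ-below x<R)) (Q<ρ⁻¹ (Q<u[≤R] (<⇒≤ x<R)))

  Q<ψL : Q < ψ L
  Q<ψL = subst (Q <_) (sym ψ-last) (Q<ρ⁻¹ Q<P)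

  ψ-m : ψ m ≡ Q
  ψ-m = ψ-above R≤m (<⇒≢ m<L) m<n

  ρ⁻¹≡L⇒≡R : ∀ {y} → y < n → ρ⁻¹ y ≡ L → y ≡ R
  ρ⁻¹≡L⇒≡R {y} y<n ρ⁻¹y≡L with <-cmp y R
  ... | tri< y<R _ _  = contradiction (trans (sym (ρ⁻¹-below y<R)) ρ⁻¹y≡L) (<⇒≢ (<-trans y<R R<L))
  ... | tri≈ _ y≡R _  = y≡R
  ... | tri> _ _ R<y  = contradiction (trans (sym (ρ⁻¹-above R<y)) ρ⁻¹y≡L) (<⇒≢ (≤-<-trans (pred-mono-≤ (s≤s⁻¹ y<n)) ≤-refl))

  ψ≤L : ∀ {x} → x < n → ψ x ≤ L
  ψ≤L x<n = s≤s⁻¹ (ψ-maps-into _ x<n)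

  no-132-ending-at-L : ∀ {i j} → i < j → j < L → ψ i < ψ L → ψ L < ψ j → ⊥
  no-132-ending-at-L {i} {j} i<j j<L ψi<ψL ψL<ψj with j <? R
  ... | no j≮R = contradiction (<-trans Q<ψL ψL<ψj) (≤⇒≯ (ψ-above≤Q (≮⇒≥ j≮R) (<⇒≢ j<L) (<-trans j<L L<n)))
  ... | yes j<R with P ≟ R
  ...   | yes P≡R = contradiction ψL<ψj (≤⇒≯ (subst (ψ j ≤_) (sym (trans ψ-last (trans (cong ρ⁻¹ P≡R) ρ⁻¹-first)))
                                                 (ψ≤L (<-trans j<R R<n))))
  ...   | no P≢R  = avoids i j R i<j j<R R<n ui<P P<uj
    where
    i<R = <-trans i<j j<R
    P<R = ≤∧≢⇒< P≤R P≢R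
    ρ⁻¹P≡P = ρ⁻¹-below P<R
    ρ⁻¹ui<ρ⁻¹P = subst₂ _<_ (ψ-below i<R) ψ-last ψi<ψL
    ρ⁻¹P<ρ⁻¹uj = subst₂ _<_ ψ-last (ψ-below j<R) ψL<ψj
    ui<P : u i < P
    ui<P with u i ≟ R
    ... | yes ui≡R = contradiction (subst₂ _<_ (trans (cong ρ⁻¹ ui≡R) ρ⁻¹-first) ρ⁻¹P≡P ρ⁻¹ui<ρ⁻¹P)
                                   (≤⇒≯ (m≤n⇒m≤1+n (≤-trans P≤R R≤m)))
    ... | no ui≢R  = ρ⁻¹-reflects-< ui≢R P≢R ρ⁻¹ui<ρ⁻¹P
    P<uj : P < u j
    P<uj with u j ≟ R
    ... | yes uj≡R = subst (P <_) (sym uj≡R) P<R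
    ... | no uj≢R  = ρ⁻¹-reflects-< P≢R uj≢R ρ⁻¹P<ρ⁻¹uj

  no-132-ending-between-R-and-L : ∀ {i j k} → i < j → j < k → R ≤ k → k < L → ψ i < ψ k → ψ k < ψ j → ⊥
  no-132-ending-between-R-and-L {i} {j} {k} i<j j<k R≤k k<L ψi<ψk ψk<ψj =
    avoids (suc i) (suc j) (suc k) (s≤s i<j) (s≤s j<k) (s≤s k<L)
      (subst₂ _<_ (ψ-above R≤i (<⇒≢ i<L) (<-trans i<L L<n)) (ψ-above R≤k (<⇒≢ k<L) (<-trans k<L L<n)) ψi<ψk)
      (subst₂ _<_ (ψ-above R≤k (<⇒≢ k<L) (<-trans k<L L<n)) (ψ-above R≤j (<⇒≢ j<L) (<-trans j<L L<n)) ψk<ψj)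
    where
    j<L = <-trans j<k k<L
    i<L = <-trans i<j j<L
    R≤i : R ≤ i
    R≤i = ≮⇒≥ λ i<R → <⇒≱ (<-trans (Q<ψ-below i<R) ψi<ψk) (ψ-above≤Q R≤k (<⇒≢ k<L) (<-trans k<L L<n))
    R≤j = ≤-trans R≤i (<⇒≤ i<j)

  module _ {i j k} (i<j : i < j) (j<k : j < k) (k<R : k < R) where
    private
      j<R = <-trans j<k k<R
      i<R = <-trans i<j j<R
      k<n = <-trans k<R R<n
      j<n = <-trans j<R R<n
      ψi≡ρ⁻¹ui = ψ-below i<R
      ψj≡ρ⁻¹uj = ψ-below j<R
      ψk≡ρ⁻¹uk = ψ-below k<R

    no-132-ending-before-R : ψ i < ψ k → ψ k < ψ j → ⊥
    no-132-ending-before-R ψi<ψk ψk<ψj with u i ≟ R | u k ≟ R | u j ≟ R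
    ... | yes ui≡R | _ | _ = contradiction (subst₂ _<_ (trans ψi≡ρ⁻¹ui (trans (cong ρ⁻¹ ui≡R) ρ⁻¹-first)) refl ψi<ψk)
                                           (≤⇒≯ (ψ≤L k<n))
    ... | no _ | yes uk≡R | _ = contradiction (subst₂ _<_ (trans ψk≡ρ⁻¹uk (trans (cong ρ⁻¹ uk≡R) ρ⁻¹-first)) refl ψk<ψj)
                                           (≤⇒≯ (ψ≤L j<n))
    ... | no ui≢R | no uk≢R | yes uj≡R = avoids i j k i<j j<k k<n
          (ρ⁻¹-reflects-< ui≢R uk≢R (subst₂ _<_ ψi≡ρ⁻¹ui ψk≡ρ⁻¹uk ψi<ψk)) uk<uj
      where
      j≡P : j ≡ P
      j≡P = trans (sym (involutive j j<n)) (cong u uj≡R)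
      uk<uj : u k < u j
      uk<uj = subst (u k <_) (sym uj≡R) (≤∧≢⇒< (≮⇒≥ λ R<uk → <⇒≱ (<-trans (subst (Q <_) (sym j≡P) Q<P) j<k)
                                                    (R<u⇒≤Q k<n R<uk)) uk≢R)
    ... | no ui≢R | no uk≢R | no uj≢R = avoids i j k i<j j<k k<n
          (ρ⁻¹-reflects-< ui≢R uk≢R (subst₂ _<_ ψi≡ρ⁻¹ui ψk≡ρ⁻¹uk ψi<ψk))
          (ρ⁻¹-reflects-< uk≢R uj≢R (subst₂ _<_ ψk≡ρ⁻¹uk ψj≡ρ⁻¹uj ψk<ψj))

  ψ-avoids : Avoids132On ψ n
  ψ-avoids i j k i<j j<k k<n ψi<ψk ψk<ψj with k ≟ L | k <? R
  ... | yes refl | _       = no-132-ending-at-L i<j j<k ψi<ψk ψk<ψj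
  ... | no k≢L   | yes k<R = no-132-ending-before-R i<j j<k k<R ψi<ψk ψk<ψj
  ... | no k≢L   | no k≮R  = no-132-ending-between-R-and-L i<j j<k (≮⇒≥ k≮R) (≤∧≢⇒< (s≤s⁻¹ k<n) k≢L) ψi<ψk ψk<ψj

  ψ-Inv132 : Inv132 ψ n
  ψ-Inv132 = mkInv132 ψ-maps-into ψ-involutive ψ-avoids

  ψ0≢L : ψ 0 ≢ L
  ψ0≢L ψ0≡L = contradiction (subst (Q <_) P≡0 Q<P) λ ()
    where
    0<R = ≤-<-trans z≤n Q<R
    u0≡R = ρ⁻¹≡L⇒≡R (maps-into 0 (<-trans 0<R R<n)) (trans (sym (ψ-below 0<R)) ψ0≡L)
    P≡0 : P ≡ 0
    P≡0 = trans (cong u (sym u0≡R)) (involutive 0 (<-trans 0<R R<n))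

  ¬ψ-fixed-fixed : ¬ (ψ L ≡ L × ψ m ≡ m)
  ¬ψ-fixed-fixed (_ , ψm≡m) = <⇒≢ (<-≤-trans Q<R R≤m) (trans (sym ψ-m) ψm≡m)

  Φ∘Ψ≗id : ∀ x → x < n → Φ m ψ x ≡ u x
  Φ∘Ψ≗id x x<n = begin
    Φ m ψ x         ≡⟨ cong (λ R′ → rot R′ L (ψ (rot⁻¹ R′ L x))) (cong (m ∸_) ψ-m) ⟩
    ρ (ψ (ρ⁻¹ x))   ≡⟨ ρ∘ρ⁻¹ (maps-into _ (ρ-maps-into _ (ρ⁻¹-maps-into x x<n))) ⟩
    u (ρ (ρ⁻¹ x))   ≡⟨ cong u (ρ∘ρ⁻¹ x<n) ⟩
    u x             ∎
    where open ≡-Reasoning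

  ψ-rlmax : rlmaxOn ψ n + 2 ≡ rlmaxOn u n
  ψ-rlmax = begin
    rlmaxOn ψ n + 2       ≡⟨ sym (Φ-Properties.φ-rlmax m ψ ψ-Inv132 ψ0≢L ¬ψ-fixed-fixed) ⟩
    rlmaxOn (Φ m ψ) n     ≡⟨ rlmaxOn-cong Φ∘Ψ≗id ⟩
    rlmaxOn u n           ∎
    where open ≡-Reasoning

Ψ-cong : ∀ m {f g} → (∀ i → i < suc (suc m) → f i ≡ g i) → ∀ x → x < suc (suc m) → Ψ m f x ≡ Ψ m g x
Ψ-cong m {f} {g} f≗g x x<n rewrite f≗g (suc m) ≤-refl =
  cong (rot⁻¹ R (suc m)) (f≗g _ (Rotation.ρ-maps-into R (suc m) (m≤n⇒m≤1+n (m∸n≤m m (g (suc m)))) x x<n))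
  where R = m ∸ g (suc m)

strip : (ℕ → ℕ) → ℕ → ℕ
strip f = pred ∘ f ∘ suc

module Strip (m : ℕ) (f : ℕ → ℕ) (I : Inv132 f (suc (suc m))) (f0≡L : f 0 ≡ suc m) where
  open Inv132 I

  L = suc m
  n = suc L

  fL≡0 : f L ≡ 0
  fL≡0 = trans (cong f (sym f0≡L)) (involutive 0 (s≤s z≤n))

  1+i<n : ∀ {i} → i < m → suc i < n
  1+i<n i<m = s≤s (s≤s (<⇒≤ i<m))

  0<f[1+i] : ∀ {i} → i < m → 0 < f (suc i)
  0<f[1+i] {i} i<m = n≢0⇒n>0 λ f[1+i]≡0 →
    <⇒≢ i<m (sym (suc-injective (injective L (suc i) ≤-refl (1+i<n i<m) (trans fL≡0 (sym f[1+i]≡0)))))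

  f[1+i]≤m : ∀ {i} → i < m → f (suc i) ≤ m
  f[1+i]≤m {i} i<m = s≤s⁻¹ (≤∧≢⇒< (s≤s⁻¹ (maps-into (suc i) (1+i<n i<m)))
    λ f[1+i]≡L → 0≢1+n (sym (injective (suc i) 0 (1+i<n i<m) (s≤s z≤n) (trans f[1+i]≡L (sym f0≡L)))))

  suc-strip : ∀ {i} → i < m → suc (strip f i) ≡ f (suc i)
  suc-strip i<m = suc-pred (f _) ⦃ >-nonZero (0<f[1+i] i<m) ⦄

  strip-Inv132 : Inv132 (strip f) m
  strip-Inv132 = mkInv132
    (λ i i<m → subst (_≤ m) (sym (suc-strip i<m)) (f[1+i]≤m i<m))
    (λ i i<m → trans (cong (pred ∘ f) (suc-strip i<m)) (cong pred (involutive (suc i) (1+i<n i<m))))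
    (λ i j k i<j j<k k<m a b → avoids (suc i) (suc j) (suc k) (s≤s i<j) (s≤s j<k) (1+i<n k<m)
      (subst₂ _<_ (suc-strip (<-trans i<j (<-trans j<k k<m))) (suc-strip k<m) (s≤s a))
      (subst₂ _<_ (suc-strip k<m) (suc-strip (<-trans j<k k<m)) (s≤s b)))

  0-isRLMax : IsRLMaxOn f n 0
  0-isRLMax i i<n 0<i = subst (f i <_) (sym f0≡L) (≤∧≢⇒< (s≤s⁻¹ (maps-into i i<n))
    λ fi≡L → >⇒≢ 0<i (injective i 0 i<n (s≤s z≤n) (trans fi≡L (sym f0≡L))))

  isRLMax-suc⇔strip : ∀ {i} → i < m → χ (isRLMaxOn? f n (suc i)) ≡ χ (isRLMaxOn? (strip f) m i)
  isRLMax-suc⇔strip {i} i<m = χ-cong (isRLMaxOn? f n (suc i)) (isRLMaxOn? (strip f) m i) to from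
    where
    to : IsRLMaxOn f n (suc i) → IsRLMaxOn (strip f) m i
    to max x x<m i<x = s≤s⁻¹ (subst₂ _<_ (sym (suc-strip x<m)) (sym (suc-strip i<m)) (max (suc x) (1+i<n x<m) (s≤s i<x)))
    from : IsRLMaxOn (strip f) m i → IsRLMaxOn f n (suc i)
    from max (suc x) 1+x<n (s≤s i<x) with m≤n⇒m<n∨m≡n (s≤s⁻¹ (s≤s⁻¹ 1+x<n))
    ... | inj₁ x<m  = subst₂ _<_ (suc-strip x<m) (suc-strip i<m) (s≤s (max x x<m i<x))
    ... | inj₂ refl = subst (_< f (suc i)) (sym fL≡0) (0<f[1+i] i<m)

  strip-rlmax : rlmaxOn f n ≡ rlmaxOn (strip f) m + 2
  strip-rlmax = begin
    rlmaxOn f n  ≡⟨ sum-suc (λ j → χ (isRLMaxOn? f n j)) L ⟩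
    χ (isRLMaxOn? f n 0) + (∑[ i < m ] χ (isRLMaxOn? f n (suc i)) + χ (isRLMaxOn? f n L))
      ≡⟨ cong₂ _+_ (χ-yes (isRLMaxOn? f n 0) 0-isRLMax)
                   (cong₂ _+_ (sum-cong m (λ i → isRLMax-suc⇔strip)) (χ-yes (isRLMaxOn? f n L) (last-isRLMaxOn f L))) ⟩
    1 + (rlmaxOn (strip f) m + 1)  ≡⟨ +-comm 1 (rlmaxOn (strip f) m + 1) ⟩
    rlmaxOn (strip f) m + 1 + 1    ≡⟨ +-assoc (rlmaxOn (strip f) m) 1 1 ⟩
    rlmaxOn (strip f) m + 2        ∎
    where open ≡-Reasoning

data Position (m : ℕ) : ℕ → Set where
  first : Position m 0
  inner : ∀ {y} → y < m → Position m (suc y)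
  last  : Position m (suc m)

position : ∀ {m x} → x < suc (suc m) → Position m x
position {m} {zero}  _ = first
position {m} {suc y} 1+y<n with m≤n⇒m<n∨m≡n (s≤s⁻¹ (s≤s⁻¹ 1+y<n))
... | inj₁ y<m  = inner y<m
... | inj₂ refl = last

opaque
  wrap : ℕ → (ℕ → ℕ) → ℕ → ℕ
  wrap m g zero    = suc m
  wrap m g (suc y) with y <? m
  ... | yes _ = suc (g y)
  ... | no _  = 0

  wrap-first : ∀ m g → wrap m g 0 ≡ suc m
  wrap-first m g = refl

  wrap-inner : ∀ m g {y} → y < m → wrap m g (suc y) ≡ suc (g y)
  wrap-inner m g {y} y<m with y <? m
  ... | yes _  = refl
  ... | no y≮m = contradiction y<m y≮m

  wrap-last : ∀ m g → wrap m g (suc m) ≡ 0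
  wrap-last m g with m <? m
  ... | yes m<m = contradiction m<m (<-irrefl refl)
  ... | no _    = refl

wrap-cong : ∀ m {g h} → (∀ i → i < m → g i ≡ h i) → ∀ x → x < suc (suc m) → wrap m g x ≡ wrap m h x
wrap-cong m {g} {h} g≗h x x<n with position x<n
... | first     = trans (wrap-first m g) (sym (wrap-first m h))
... | inner y<m = trans (wrap-inner m g y<m) (trans (cong suc (g≗h _ y<m)) (sym (wrap-inner m h y<m)))
... | last      = trans (wrap-last m g) (sym (wrap-last m h))

wrap∘strip : ∀ m {f} → Inv132 f (suc (suc m)) → f 0 ≡ suc m → ∀ x → x < suc (suc m) → wrap m (strip f) x ≡ f x
wrap∘strip m {f} I f0≡L x x<n with position x<n
... | first     = trans (wrap-first m _) (sym f0≡L)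
... | inner y<m = trans (wrap-inner m _ y<m) (Strip.suc-strip m f I f0≡L y<m)
... | last      = trans (wrap-last m _) (sym (Strip.fL≡0 m f I f0≡L))

module Wrap (m : ℕ) (g : ℕ → ℕ) (I : Inv132 g m) where
  open Inv132 I

  n = suc (suc m)
  w = wrap m g

  wrap-maps-into : MapsInto w n
  wrap-maps-into x x<n with position x<n
  ... | first     = subst (_< n) (sym (wrap-first m g)) ≤-refl
  ... | inner y<m = subst (_< n) (sym (wrap-inner m g y<m)) (s≤s (m<n⇒m<1+n (maps-into _ y<m)))
  ... | last      = subst (_< n) (sym (wrap-last m g)) (s≤s z≤n)

  wrap-involutive : InvolutiveOn w n
  wrap-involutive x x<n with position x<n
  ... | first     = trans (cong w (wrap-first m g)) (wrap-last m g)
  ... | inner y<m = trans (cong w (wrap-inner m g y<m))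
                      (trans (wrap-inner m g (maps-into _ y<m)) (cong suc (involutive _ y<m)))
  ... | last      = trans (cong w (wrap-last m g)) (wrap-first m g)

  wrap-avoids : Avoids132On w n
  wrap-avoids zero j k i<j j<k k<n wi<wk wk<wj =
    <⇒≱ (subst (_< w k) (wrap-first m g) wi<wk) (s≤s⁻¹ (wrap-maps-into k k<n))
  wrap-avoids (suc i) (suc j) (suc k) (s≤s i<j) (s≤s j<k) k<n wi<wk wk<wj with position k<n
  ... | last      = n≮0 (subst (w (suc i) <_) (wrap-last m g) wi<wk)
  ... | inner k<m = avoids i j k i<j j<k k<m
    (s≤s⁻¹ (subst₂ _<_ (wrap-inner m g (<-trans i<j (<-trans j<k k<m))) (wrap-inner m g k<m) wi<wk))
    (s≤s⁻¹ (subst₂ _<_ (wrap-inner m g k<m) (wrap-inner m g (<-trans j<k k<m)) wk<wj))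

  wrap-Inv132 : Inv132 w n
  wrap-Inv132 = mkInv132 wrap-maps-into wrap-involutive wrap-avoids

  strip∘wrap : ∀ i → i < m → strip w i ≡ g i
  strip∘wrap i i<m = cong pred (wrap-inner m g i<m)

  wrap-rlmax : rlmaxOn w n ≡ rlmaxOn g m + 2
  wrap-rlmax = trans (Strip.strip-rlmax m w wrap-Inv132 (wrap-first m g)) (cong (_+ 2) (rlmaxOn-cong strip∘wrap))

module _ {f L} (I : Inv132 f (suc L)) (fL≡L : f L ≡ L) where
  open Inv132 I

  drop-fixed-last-Inv132 : Inv132 f L
  drop-fixed-last-Inv132 = mkInv132
    (λ i i<L → ≤∧≢⇒< (s≤s⁻¹ (maps-into i (m<n⇒m<1+n i<L)))
      λ fi≡L → <⇒≢ i<L (injective i L (m<n⇒m<1+n i<L) ≤-refl (trans fi≡L (sym fL≡L))))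
    (λ i i<L → involutive i (m<n⇒m<1+n i<L))
    (λ i j k i<j j<k k<L → avoids i j k i<j j<k (m<n⇒m<1+n k<L))

opaque
  add-fixed-last : ℕ → (ℕ → ℕ) → ℕ → ℕ
  add-fixed-last L g x with x ≟ L
  ... | yes _ = L
  ... | no _  = g x

  add-fixed-last-L : ∀ L g → add-fixed-last L g L ≡ L
  add-fixed-last-L L g with L ≟ L
  ... | yes _   = refl
  ... | no L≢L  = contradiction refl L≢L

  add-fixed-last-≢ : ∀ L g {x} → x ≢ L → add-fixed-last L g x ≡ g x
  add-fixed-last-≢ L g {x} x≢L with x ≟ L
  ... | yes x≡L = contradiction x≡L x≢L
  ... | no _    = refl

module _ {g L} (I : Inv132 g L) where
  open Inv132 I
  private
    a = add-fixed-last L g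
    a-below : ∀ {x} → x < L → a x ≡ g x
    a-below x<L = add-fixed-last-≢ L g (<⇒≢ x<L)

  add-fixed-last-Inv132 : Inv132 a (suc L)
  add-fixed-last-Inv132 = mkInv132 a-maps-into a-involutive a-avoids
    where
    a-maps-into : MapsInto a (suc L)
    a-maps-into x x≤L with x ≟ L
    ... | yes refl = subst (_< suc L) (sym (add-fixed-last-L L g)) ≤-refl
    ... | no x≢L   = subst (_< suc L) (sym (add-fixed-last-≢ L g x≢L))
                       (m<n⇒m<1+n (maps-into x (≤∧≢⇒< (s≤s⁻¹ x≤L) x≢L)))
    a-involutive : InvolutiveOn a (suc L)
    a-involutive x x≤L with x ≟ L
    ... | yes refl = trans (cong a (add-fixed-last-L L g)) (add-fixed-last-L L g)
    ... | no x≢L   = let x<L = ≤∧≢⇒< (s≤s⁻¹ x≤L) x≢L in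
                     trans (cong a (a-below x<L)) (trans (a-below (maps-into x x<L)) (involutive x x<L))
    a-avoids : Avoids132On a (suc L)
    a-avoids i j k i<j j<k k≤L ai<ak ak<aj with k ≟ L
    ... | yes refl = <-asym (subst (_< a j) (add-fixed-last-L L g) ak<aj) (subst (_< L) (sym (a-below j<k)) (maps-into j j<k))
    ... | no k≢L   = let k<L = ≤∧≢⇒< (s≤s⁻¹ k≤L) k≢L in avoids i j k i<j j<k k<L
      (subst₂ _<_ (a-below (<-trans i<j (<-trans j<k k<L))) (a-below k<L) ai<ak)
      (subst₂ _<_ (a-below k<L) (a-below (<-trans j<k k<L)) ak<aj)

opaque
  -- junk value 0 outside [0, n)
  toFun : ∀ {n} → Word n → ℕ → ℕ
  toFun {n} π i with i <? n
  ... | yes i<n = toℕ (lookup π (fromℕ< i<n))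
  ... | no _    = 0

  toFun-lookup : ∀ {n} (π : Word n) (j : Fin n) → toFun π (toℕ j) ≡ toℕ (lookup π j)
  toFun-lookup {n} π j with toℕ j <? n
  ... | yes j<n = cong (toℕ ∘ lookup π) (Finₚ.fromℕ<-toℕ j j<n)
  ... | no j≮n  = contradiction (Finₚ.toℕ<n j) j≮n

toFun-at : ∀ {n} (π : Word n) {i} (i<n : i < n) → toFun π i ≡ toℕ (lookup π (fromℕ< i<n))
toFun-at π i<n = trans (cong (toFun π) (sym (Finₚ.toℕ-fromℕ< i<n))) (toFun-lookup π (fromℕ< i<n))

toFun-maps-into : ∀ {n} (π : Word n) → MapsInto (toFun π) n
toFun-maps-into π i i<n = subst (_< _) (sym (toFun-at π i<n)) (Finₚ.toℕ<n _)

fromFun : ∀ n (f : ℕ → ℕ) → MapsInto f n → Word n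
fromFun n f f-into = tabulate λ j → fromℕ< (f-into (toℕ j) (Finₚ.toℕ<n j))

lookup-fromFun : ∀ n f f-into (j : Fin n) → toℕ (lookup (fromFun n f f-into) j) ≡ f (toℕ j)
lookup-fromFun n f f-into j = trans (cong toℕ (lookup∘tabulate _ j)) (Finₚ.toℕ-fromℕ< _)

toFun-fromFun : ∀ n f f-into i → i < n → toFun (fromFun n f f-into) i ≡ f i
toFun-fromFun n f f-into i i<n =
  trans (toFun-at _ i<n) (trans (lookup-fromFun n f f-into (fromℕ< i<n)) (cong f (Finₚ.toℕ-fromℕ< i<n)))

fromFun-toFun : ∀ {n} (π : Word n) → fromFun n (toFun π) (toFun-maps-into π) ≡ π
fromFun-toFun π = trans (tabulate-cong λ j → Finₚ.toℕ-injective (trans (Finₚ.toℕ-fromℕ< _) (toFun-lookup π j)))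
  (tabulate∘lookup π)

fromFun-cong : ∀ n {f g} f-into g-into → (∀ i → i < n → f i ≡ g i) → fromFun n f f-into ≡ fromFun n g g-into
fromFun-cong n f-into g-into f≗g = tabulate-cong λ j → Finₚ.toℕ-injective
  (trans (Finₚ.toℕ-fromℕ< _) (trans (f≗g (toℕ j) (Finₚ.toℕ<n j)) (sym (Finₚ.toℕ-fromℕ< _))))

involutive-toFun : ∀ {n} (π : Word n) → IsInvolution π → InvolutiveOn (toFun π) n
involutive-toFun π π∘π≗id i i<n = begin
  toFun π (toFun π i)                  ≡⟨ cong (toFun π) (toFun-at π i<n) ⟩
  toFun π (toℕ (lookup π (fromℕ< i<n))) ≡⟨ toFun-lookup π _ ⟩
  toℕ (lookup π (lookup π (fromℕ< i<n))) ≡⟨ cong toℕ (π∘π≗id _) ⟩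
  toℕ (fromℕ< i<n)                     ≡⟨ Finₚ.toℕ-fromℕ< i<n ⟩
  i                                    ∎
  where open ≡-Reasoning

isInvolution-fromFun : ∀ n f f-into → InvolutiveOn f n → IsInvolution (fromFun n f f-into)
isInvolution-fromFun n f f-into f∘f≗id j = Finₚ.toℕ-injective
  (trans (lookup-fromFun n f f-into _) (trans (cong f (lookup-fromFun n f f-into j)) (f∘f≗id (toℕ j) (Finₚ.toℕ<n j))))

involution⇒perm : ∀ {n} (π : Word n) → IsInvolution π → IsPerm π
involution⇒perm π π∘π≗id i j πi≡πj = trans (sym (π∘π≗id i)) (trans (cong (lookup π) πi≡πj) (π∘π≗id j))

avoids-toFun : ∀ {n} (π : Word n) → Avoids132 π → Avoids132On (toFun π) n
avoids-toFun π π-avoids i j k i<j j<k k<n πi<πk πk<πj = π-avoids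
  ( fromℕ< i<n , fromℕ< j<n , fromℕ< k<n
  , subst₂ _<_ (sym (Finₚ.toℕ-fromℕ< i<n)) (sym (Finₚ.toℕ-fromℕ< j<n)) i<j
  , subst₂ _<_ (sym (Finₚ.toℕ-fromℕ< j<n)) (sym (Finₚ.toℕ-fromℕ< k<n)) j<k
  , subst₂ _<_ (toFun-at π i<n) (toFun-at π k<n) πi<πk
  , subst₂ _<_ (toFun-at π k<n) (toFun-at π j<n) πk<πj )
  where
  j<n = <-trans j<k k<n
  i<n = <-trans i<j j<n

avoids132-fromFun : ∀ n f f-into → Avoids132On f n → Avoids132 (fromFun n f f-into)
avoids132-fromFun n f f-into f-avoids (i , j , k , i<j , j<k , πi<πk , πk<πj) =
  f-avoids (toℕ i) (toℕ j) (toℕ k) i<j j<k (Finₚ.toℕ<n k)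
    (subst₂ _<_ (lookup-fromFun n f f-into i) (lookup-fromFun n f f-into k) πi<πk)
    (subst₂ _<_ (lookup-fromFun n f f-into k) (lookup-fromFun n f f-into j) πk<πj)

count-tabulate : ∀ {A : Set} {P : A → Set} (P? : Decidable P) n (F : Fin n → A) (ψ : ℕ → ℕ) →
                 (∀ k → χ (P? (F k)) ≡ ψ (toℕ k)) → Vec.count P? (tabulate F) ≡ ∑[ i < n ] ψ i
count-tabulate P? zero    F ψ χ≗ψ = refl
count-tabulate P? (suc n) F ψ χ≗ψ with P? (F Fin.zero) | χ≗ψ Fin.zero
... | yes _ | 1≡ψ0 = trans (cong₂ _+_ 1≡ψ0 (count-tabulate P? n (F ∘ Fin.suc) (ψ ∘ suc) (χ≗ψ ∘ Fin.suc))) (sym (sum-suc ψ n))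
... | no _  | 0≡ψ0 = trans (cong₂ _+_ 0≡ψ0 (count-tabulate P? n (F ∘ Fin.suc) (ψ ∘ suc) (χ≗ψ ∘ Fin.suc))) (sym (sum-suc ψ n))

rlmax≡rlmaxOn-toFun : ∀ {n} (π : Word n) → rlmax π ≡ rlmaxOn (toFun π) n
rlmax≡rlmaxOn-toFun {n} π = count-tabulate (isRLMax? π) n (λ j → j) (λ j → χ (isRLMaxOn? (toFun π) n j))
  λ k → χ-cong (isRLMax? π k) (isRLMaxOn? (toFun π) n (toℕ k)) (to k) (from k)
  where
  to : ∀ k → IsRLMax π k → IsRLMaxOn (toFun π) n (toℕ k)
  to k max i i<n k<i = subst₂ _<_ (sym (toFun-at π i<n)) (sym (toFun-lookup π k))
    (max (fromℕ< i<n) (subst (toℕ k <_) (sym (Finₚ.toℕ-fromℕ< i<n)) k<i))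
  from : ∀ k → IsRLMaxOn (toFun π) n (toℕ k) → IsRLMax π k
  from k max i k<i = subst₂ _<_ (toFun-lookup π i) (toFun-lookup π k) (max (toℕ i) (Finₚ.toℕ<n i) k<i)

AvInv : ℕ → ℕ → Set
AvInv n s = Σ[ π ∈ Word n ] (True (isPerm? π) × True (isInvolution? π) × True (avoids132? π) × rlmax π ≡ s)

fun : ∀ {n s} → AvInv n s → ℕ → ℕ
fun = toFun ∘ proj₁

fun-Inv132 : ∀ {n s} (x : AvInv n s) → Inv132 (fun x) n
fun-Inv132 (π , _ , inv , av , _) = mkInv132 (toFun-maps-into π) (involutive-toFun π (toWitness inv)) (avoids-toFun π (toWitness av))

fun-rlmax : ∀ {n s} (x : AvInv n s) → rlmaxOn (fun x) n ≡ s
fun-rlmax (π , _ , _ , _ , rlmax≡s) = trans (sym (rlmax≡rlmaxOn-toFun π)) rlmax≡s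

mkAvInv : ∀ {n s f} → Inv132 f n → rlmaxOn f n ≡ s → AvInv n s
mkAvInv {n} {s} {f} I rlmax≡s = π , fromWitness (involution⇒perm π π-inv) , fromWitness π-inv
  , fromWitness (avoids132-fromFun n f f-into (Inv132.avoids I))
  , trans (rlmax≡rlmaxOn-toFun π) (trans (rlmaxOn-cong (toFun-fromFun n f f-into)) rlmax≡s)
  where
  f-into = Inv132.maps-into I
  π = fromFun n f f-into
  π-inv = isInvolution-fromFun n f f-into (Inv132.involutive I)

fun-mkAvInv : ∀ {n s f} (I : Inv132 f n) (rlmax≡s : rlmaxOn f n ≡ s) → ∀ i → i < n → fun (mkAvInv I rlmax≡s) i ≡ f i
fun-mkAvInv {n} {f = f} I _ = toFun-fromFun n f (Inv132.maps-into I)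

AvInv-≡ : ∀ {n s} (x y : AvInv n s) → proj₁ x ≡ proj₁ y → x ≡ y
AvInv-≡ (π , p , i , a , r) (.π , p′ , i′ , a′ , r′) refl
  rewrite T-irrelevant p p′ | T-irrelevant i i′ | T-irrelevant a a′ | ≡-irrelevant r r′ = refl

AvInv-ext : ∀ {n s} (x y : AvInv n s) → (∀ i → i < n → fun x i ≡ fun y i) → x ≡ y
AvInv-ext {n} (π , _) (σ , _) x≗y = AvInv-≡ _ _ (begin
  π                                       ≡⟨ fromFun-toFun π ⟨
  fromFun n (toFun π) (toFun-maps-into π) ≡⟨ fromFun-cong n (toFun-maps-into π) (toFun-maps-into σ) x≗y ⟩
  fromFun n (toFun σ) (toFun-maps-into σ) ≡⟨ fromFun-toFun σ ⟩
  σ                                       ∎)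
  where open ≡-Reasoning

Σ-T-≡ : ∀ {A : Set} {b : A → Bool} {x y : Σ A (T ∘ b)} → proj₁ x ≡ proj₁ y → x ≡ y
Σ-T-≡ {x = a , p} {y = .a , q} refl = cong (a ,_) (T-irrelevant p q)

split-by : ∀ {A : Set} {P : A → Set} (P? : ∀ x → Dec (P x)) → A ↔ (Σ A (True ∘ P?) ⊎ Σ A (False ∘ P?))
split-by {A} {P} P? = mk↔ₛ′ (λ x → classify x (P? x)) from (λ { (inj₁ (x , t)) → classify-yes x (P? x) t t
                                                             ; (inj₂ (x , f)) → classify-no x (P? x) f f })
                                                        (λ x → from∘classify x (P? x))
  where
  classify : ∀ x → Dec (P x) → Σ A (True ∘ P?) ⊎ Σ A (False ∘ P?)
  classify x (yes p) = inj₁ (x , fromWitness p)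
  classify x (no ¬p) = inj₂ (x , fromWitnessFalse ¬p)
  from : Σ A (True ∘ P?) ⊎ Σ A (False ∘ P?) → A
  from (inj₁ (x , _)) = x
  from (inj₂ (x , _)) = x
  classify-yes : ∀ x (d : Dec (P x)) → True d → (t : True (P? x)) → classify x d ≡ inj₁ (x , t)
  classify-yes x (yes p) _ t = cong inj₁ (Σ-T-≡ refl)
  classify-no : ∀ x (d : Dec (P x)) → False d → (f : False (P? x)) → classify x d ≡ inj₂ (x , f)
  classify-no x (no ¬p) _ f = cong inj₂ (Σ-T-≡ refl)
  from∘classify : ∀ x d → from (classify x d) ≡ x
  from∘classify x (yes _) = refl
  from∘classify x (no _)  = refl

module Decomposition (m : ℕ) where

  L = suc m
  n = suc L

  m<n : m < n
  m<n = m<n⇒m<1+n ≤-refl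

  outer-cycle? : ∀ {s} (x : AvInv n s) → Dec (fun x 0 ≡ L)
  outer-cycle? x = fun x 0 ≟ L

  fixed-fixed? : ∀ {s} (x : AvInv n s) → Dec (fun x L ≡ L × fun x m ≡ m)
  fixed-fixed? x = (fun x L ≟ L) ×-dec (fun x m ≟ m)

  WithOuterCycle NoOuterCycle EndingFixedFixed Generic : ℕ → Set
  WithOuterCycle s   = Σ (AvInv n s) λ x → True (outer-cycle? x)
  NoOuterCycle s     = Σ (AvInv n s) λ x → False (outer-cycle? x)
  EndingFixedFixed s = Σ (NoOuterCycle s) λ y → True (fixed-fixed? (proj₁ y))
  Generic s          = Σ (NoOuterCycle s) λ y → False (fixed-fixed? (proj₁ y))

  decompose : ∀ s → AvInv n s ↔ (WithOuterCycle s ⊎ (EndingFixedFixed s ⊎ Generic s))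
  decompose s = ↔-trans (split-by {A = AvInv n s} outer-cycle?)
                        (⊎-cong ↔-refl (split-by {A = NoOuterCycle s} λ y → fixed-fixed? (proj₁ y)))

  ¬WithOuterCycle : ∀ {s} → s < 2 → ¬ WithOuterCycle s
  ¬WithOuterCycle {s} s<2 (x , t) = <⇒≱ s<2 (subst (2 ≤_) (sym rlmax≡) (m≤n+m 2 _))
    where rlmax≡ = trans (sym (fun-rlmax x)) (Strip.strip-rlmax m (fun x) (fun-Inv132 x) (toWitness t))

  WithOuterCycle↔ : ∀ s → WithOuterCycle (2 + s) ↔ AvInv m s
  WithOuterCycle↔ s = mk↔ₛ′ unwrap rewrap unwrap∘rewrap rewrap∘unwrap
    where
    module _ (z : WithOuterCycle (2 + s)) where
      private
        x = proj₁ z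
        f0≡L = toWitness (proj₂ z)
      stripped-Inv132 = Strip.strip-Inv132 m (fun x) (fun-Inv132 x) f0≡L
      stripped-rlmax : rlmaxOn (strip (fun x)) m ≡ s
      stripped-rlmax = +-cancelʳ-≡ 2 _ s (trans (sym (Strip.strip-rlmax m (fun x) (fun-Inv132 x) f0≡L))
                                                (trans (fun-rlmax x) (+-comm 2 s)))
      unwrap : AvInv m s
      unwrap = mkAvInv stripped-Inv132 stripped-rlmax
    module _ (y : AvInv m s) where
      wrapped-Inv132 = Wrap.wrap-Inv132 m (fun y) (fun-Inv132 y)
      wrapped-rlmax : rlmaxOn (wrap m (fun y)) n ≡ 2 + s
      wrapped-rlmax = trans (Wrap.wrap-rlmax m (fun y) (fun-Inv132 y)) (trans (cong (_+ 2) (fun-rlmax y)) (+-comm s 2))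
      fun-rewrap : ∀ i → i < n → fun (mkAvInv wrapped-Inv132 wrapped-rlmax) i ≡ wrap m (fun y) i
      fun-rewrap = fun-mkAvInv wrapped-Inv132 wrapped-rlmax
      rewrap : WithOuterCycle (2 + s)
      rewrap = mkAvInv wrapped-Inv132 wrapped-rlmax , fromWitness (trans (fun-rewrap 0 (s≤s z≤n)) (wrap-first m (fun y)))
    unwrap∘rewrap : ∀ y → unwrap (rewrap y) ≡ y
    unwrap∘rewrap y = AvInv-ext _ y λ i i<m → begin
      fun (unwrap (rewrap y)) i             ≡⟨ fun-mkAvInv (stripped-Inv132 (rewrap y)) (stripped-rlmax (rewrap y)) i i<m ⟩
      pred (fun (proj₁ (rewrap y)) (suc i)) ≡⟨ cong pred (fun-rewrap y (suc i) (s≤s (s≤s (<⇒≤ i<m)))) ⟩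
      strip (wrap m (fun y)) i              ≡⟨ Wrap.strip∘wrap m (fun y) (fun-Inv132 y) i i<m ⟩
      fun y i                               ∎
      where open ≡-Reasoning
    rewrap∘unwrap : ∀ z → rewrap (unwrap z) ≡ z
    rewrap∘unwrap z@(x , t) = Σ-T-≡ (AvInv-ext _ x λ i i<n → begin
      fun (proj₁ (rewrap (unwrap z))) i ≡⟨ fun-rewrap (unwrap z) i i<n ⟩
      wrap m (fun (unwrap z)) i         ≡⟨ wrap-cong m (fun-mkAvInv (stripped-Inv132 z) (stripped-rlmax z)) i i<n ⟩
      wrap m (strip (fun x)) i          ≡⟨ wrap∘strip m (fun-Inv132 x) (toWitness t) i i<n ⟩
      fun x i                           ∎)
      where open ≡-Reasoning

  ¬EndingFixedFixed : ∀ {s} → s ≢ 1 → ¬ EndingFixedFixed s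
  ¬EndingFixedFixed s≢1 ((x , _) , t) =
    s≢1 (trans (sym (fun-rlmax x)) (fixed-last⇒rlmaxOn≡1 (fun-Inv132 x) (proj₁ (toWitness t))))

  EndingFixedFixed↔ : EndingFixedFixed 1 ↔ AvInv L 1
  EndingFixedFixed↔ = mk↔ₛ′ drop add add∘drop drop∘add
    where
    module _ (z : EndingFixedFixed 1) where
      private
        x = proj₁ (proj₁ z)
      fL≡L = proj₁ (toWitness (proj₂ z))
      dropped-Inv132 = drop-fixed-last-Inv132 (fun-Inv132 x) fL≡L
      dropped-rlmax : rlmaxOn (fun x) L ≡ 1
      dropped-rlmax = fixed-last⇒rlmaxOn≡1 dropped-Inv132 (proj₂ (toWitness (proj₂ z)))
      drop : AvInv L 1
      drop = mkAvInv dropped-Inv132 dropped-rlmax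
    module _ (y : AvInv L 1) where
      added-Inv132 = add-fixed-last-Inv132 (fun-Inv132 y)
      added-rlmax : rlmaxOn (add-fixed-last L (fun y)) n ≡ 1
      added-rlmax = fixed-last⇒rlmaxOn≡1 added-Inv132 (add-fixed-last-L L (fun y))
      added = mkAvInv added-Inv132 added-rlmax
      fun-added : ∀ i → i < n → fun added i ≡ add-fixed-last L (fun y) i
      fun-added = fun-mkAvInv added-Inv132 added-rlmax
      add : EndingFixedFixed 1
      add = (added , fromWitnessFalse λ f0≡L → <⇒≢ (Inv132.maps-into (fun-Inv132 y) 0 (s≤s z≤n))
                      (trans (sym (add-fixed-last-≢ L (fun y) (<⇒≢ (s≤s z≤n)))) (trans (sym (fun-added 0 (s≤s z≤n))) f0≡L)))
          , fromWitness (trans (fun-added L ≤-refl) (add-fixed-last-L L (fun y))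
                        , trans (fun-added m m<n) (trans (add-fixed-last-≢ L (fun y) (<⇒≢ ≤-refl))
                                                          (rlmaxOn≡1⇒fixed-last (fun-Inv132 y) (fun-rlmax y))))
    add∘drop : ∀ y → drop (add y) ≡ y
    add∘drop y = AvInv-ext _ y λ i i<L → begin
      fun (drop (add y)) i         ≡⟨ fun-mkAvInv (dropped-Inv132 (add y)) (dropped-rlmax (add y)) i i<L ⟩
      fun (added y) i              ≡⟨ fun-added y i (m<n⇒m<1+n i<L) ⟩
      add-fixed-last L (fun y) i   ≡⟨ add-fixed-last-≢ L (fun y) (<⇒≢ i<L) ⟩
      fun y i                      ∎
      where open ≡-Reasoning
    drop∘add : ∀ z → add (drop z) ≡ z
    drop∘add z@((x , _) , t) = Σ-T-≡ (Σ-T-≡ (AvInv-ext _ x λ i i<n → trans (fun-added (drop z) i i<n) (fixed-last≗ i i<n)))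
      where
      fixed-last≗ : ∀ i → i < n → add-fixed-last L (fun (drop z)) i ≡ fun x i
      fixed-last≗ i i<n with i ≟ L
      ... | yes refl = trans (add-fixed-last-L L _) (sym (fL≡L z))
      ... | no i≢L   = let i<L = ≤∧≢⇒< (s≤s⁻¹ i<n) i≢L in
        trans (add-fixed-last-≢ L _ i≢L) (fun-mkAvInv (dropped-Inv132 z) (dropped-rlmax z) i i<L)

  Generic↔ : ∀ s → Generic (suc s) ↔ AvInv n (3 + s)
  Generic↔ s = mk↔ₛ′ raise lower raise∘lower lower∘raise
    where
    module _ (z : Generic (suc s)) where
      private
        x = proj₁ (proj₁ z)
      module F = Φ-Properties m (fun x) (fun-Inv132 x) (toWitnessFalse (proj₂ (proj₁ z))) (toWitnessFalse (proj₂ z))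
      raised-rlmax : rlmaxOn (Φ m (fun x)) n ≡ 3 + s
      raised-rlmax = trans F.φ-rlmax (trans (cong (_+ 2) (fun-rlmax x)) (+-comm (suc s) 2))
      raise : AvInv n (3 + s)
      raise = mkAvInv F.φ-Inv132 raised-rlmax
      fun-raise : ∀ i → i < n → fun raise i ≡ Φ m (fun x) i
      fun-raise = fun-mkAvInv F.φ-Inv132 raised-rlmax
    module _ (y : AvInv n (3 + s)) where
      3≤rlmax : 3 ≤ rlmaxOn (fun y) n
      3≤rlmax = subst (3 ≤_) (sym (fun-rlmax y)) (m≤m+n 3 s)
      module G = Ψ-Properties m (fun y) (fun-Inv132 y) 3≤rlmax
      lowered-rlmax : rlmaxOn (Ψ m (fun y)) n ≡ suc s
      lowered-rlmax = +-cancelʳ-≡ 2 _ (suc s) (trans G.ψ-rlmax (trans (fun-rlmax y) (+-comm 2 (suc s))))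
      lowered = mkAvInv G.ψ-Inv132 lowered-rlmax
      fun-lowered : ∀ i → i < n → fun lowered i ≡ Ψ m (fun y) i
      fun-lowered = fun-mkAvInv G.ψ-Inv132 lowered-rlmax
      lower : Generic (suc s)
      lower = (lowered , fromWitnessFalse λ f0≡L → G.ψ0≢L (trans (sym (fun-lowered 0 (s≤s z≤n))) f0≡L))
            , fromWitnessFalse λ (fL≡L , fm≡m) → G.¬ψ-fixed-fixed
                (trans (sym (fun-lowered L ≤-refl)) fL≡L , trans (sym (fun-lowered m m<n)) fm≡m)
    raise∘lower : ∀ y → raise (lower y) ≡ y
    raise∘lower y = AvInv-ext _ y λ i i<n → begin
      fun (raise (lower y)) i       ≡⟨ fun-raise (lower y) i i<n ⟩
      Φ m (fun (lowered y)) i       ≡⟨ Φ-cong m (fun-lowered y) i i<n ⟩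
      Φ m (Ψ m (fun y)) i           ≡⟨ G.Φ∘Ψ≗id y i i<n ⟩
      fun y i                       ∎
      where open ≡-Reasoning
    lower∘raise : ∀ z → lower (raise z) ≡ z
    lower∘raise z@((x , _) , _) = Σ-T-≡ (Σ-T-≡ (AvInv-ext _ x λ i i<n → begin
      fun (lowered (raise z)) i     ≡⟨ fun-lowered (raise z) i i<n ⟩
      Ψ m (fun (raise z)) i         ≡⟨ Ψ-cong m (fun-raise z) i i<n ⟩
      Ψ m (Φ m (fun x)) i           ≡⟨ F.Ψ∘Φ≗id z i ⟩
      fun x i                       ∎))
      where open ≡-Reasoning

infixr 1 _⟫_
_⟫_ : ∀ {A B C : Set} → A ↔ B → B ↔ C → A ↔ C
_⟫_ = ↔-trans

⊎-absorbˡ : ∀ {A B : Set} → ¬ A → (A ⊎ B) ↔ B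
⊎-absorbˡ ¬a = mk↔ₛ′ (λ { (inj₁ a) → contradiction a ¬a ; (inj₂ b) → b }) inj₂
  (λ _ → refl) (λ { (inj₁ a) → contradiction a ¬a ; (inj₂ b) → refl })

¬↔Fin0 : ∀ {A : Set} → ¬ A → A ↔ Fin 0
¬↔Fin0 ¬a = mk↔ₛ′ (λ a → contradiction a ¬a) (λ ()) (λ ()) (λ a → contradiction a ¬a)

unique↔Fin1 : ∀ {A : Set} (a : A) → (∀ x → x ≡ a) → A ↔ Fin 1
unique↔Fin1 a unique = mk↔ₛ′ (λ _ → Fin.zero) (λ _ → a) (λ { Fin.zero → refl ; (Fin.suc ()) }) (sym ∘ unique)

Fin-cong : ∀ {a b} → a ≡ b → Fin a ↔ Fin b
Fin-cong refl = ↔-refl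

⊎↔Fin+ : ∀ {a b} → (Fin a ⊎ Fin b) ↔ Fin (a + b)
⊎↔Fin+ = ↔-sym Finₚ.+↔⊎

AvInv-rec₁ : ∀ m → AvInv (2 + m) 1 ↔ (AvInv (1 + m) 1 ⊎ AvInv (2 + m) 3)
AvInv-rec₁ m = decompose 1 ⟫ ⊎-absorbˡ (¬WithOuterCycle (s≤s (s≤s z≤n))) ⟫ ⊎-cong EndingFixedFixed↔ (Generic↔ 0)
  where open Decomposition m

AvInv-rec₂ : ∀ m s → AvInv (2 + m) (2 + s) ↔ (AvInv m s ⊎ AvInv (2 + m) (4 + s))
AvInv-rec₂ m s = decompose (2 + s) ⟫ ⊎-cong (WithOuterCycle↔ s) (⊎-absorbˡ (¬EndingFixedFixed λ ()) ⟫ Generic↔ (1 + s))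
  where open Decomposition m

¬AvInv-above : ∀ {n s} → n < s → ¬ AvInv n s
¬AvInv-above {n} n<s x = <⇒≱ n<s (subst (_≤ n) (fun-rlmax x) (rlmaxOn≤n (fun x) n))

¬AvInv-0 : ∀ {L} → ¬ AvInv (suc L) 0
¬AvInv-0 {L} x = <⇒≱ (s≤s z≤n) (subst (1 ≤_) (fun-rlmax x) (1≤rlmaxOn (fun x) L))

AvInv-0-0↔ : AvInv 0 0 ↔ Fin 1
AvInv-0-0↔ = unique↔Fin1 empty λ x → AvInv-ext x empty λ _ ()
  where empty = mkAvInv {f = λ _ → 0} (mkInv132 (λ _ ()) (λ _ ()) λ _ _ _ _ _ ()) refl

AvInv-1-1↔ : AvInv 1 1 ↔ Fin 1
AvInv-1-1↔ = unique↔Fin1 identity λ x → AvInv-ext x identity λ { zero 0<1 → trans (<1⇒≡0 (Inv132.maps-into (fun-Inv132 x) 0 0<1))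
                                                                       (sym (fun-mkAvInv I rlmax≡1 0 0<1))
                                                                 ; (suc _) (s≤s ()) }
  where
  <1⇒≡0 : ∀ {y} → y < 1 → y ≡ 0
  <1⇒≡0 (s≤s z≤n) = refl
  I : Inv132 (λ _ → 0) 1
  I = mkInv132 (λ _ _ → s≤s z≤n) (λ { zero _ → refl ; (suc _) (s≤s ()) }) λ { _ _ zero _ () _ ; _ _ (suc _) _ _ (s≤s ()) }
  rlmax≡1 = χ-yes (isRLMaxOn? (λ _ → 0) 1 0) (last-isRLMaxOn (λ _ → 0) 0)
  identity = mkAvInv I rlmax≡1

module Counting (G : ℕ → ℕ → ℕ)
  (G-0-0 : G 0 0 ≡ 1) (G-1-1 : G 1 1 ≡ 1) (G-suc-0 : ∀ L → G (suc L) 0 ≡ 0) (G-above : ∀ n s → n < s → G n s ≡ 0)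
  (G-rec₁ : ∀ m → G (2 + m) 1 ≡ G (1 + m) 1 + G (2 + m) 3)
  (G-rec₂ : ∀ m s → G (2 + m) (2 + s) ≡ G m s + G (2 + m) (4 + s)) where

  empty↔ : ∀ {n s} → ¬ AvInv n s → G n s ≡ 0 → AvInv n s ↔ Fin (G n s)
  empty↔ ¬x G≡0 = ¬↔Fin0 ¬x ⟫ Fin-cong (sym G≡0)

  above↔ : ∀ {n s} → n < s → AvInv n s ↔ Fin (G n s)
  above↔ {n} {s} n<s = empty↔ (¬AvInv-above n<s) (G-above n s n<s)

  module _ (m : ℕ) (ih₁ : AvInv (1 + m) 1 ↔ Fin (G (1 + m) 1)) (ih₂ : ∀ s → AvInv m s ↔ Fin (G m s)) where

    count↔-by-gap : ∀ k s → s + k ≡ 4 + m → AvInv (2 + m) s ↔ Fin (G (2 + m) s)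
    count↔-by-gap zero s s+0≡ = above↔ (subst (2 + m <_) (trans (sym s+0≡) (+-identityʳ s)) (m<n⇒m<1+n ≤-refl))
    count↔-by-gap (suc zero) s s+1≡ = above↔ (subst (2 + m <_) (suc-injective (trans (sym s+1≡) (+-comm s 1))) ≤-refl)
    count↔-by-gap (suc (suc k)) zero _ = empty↔ ¬AvInv-0 (G-suc-0 (1 + m))
    count↔-by-gap (suc (suc k)) (suc zero) 3+k≡ =
      AvInv-rec₁ m ⟫ ⊎-cong ih₁ (count↔-by-gap k 3 3+k≡) ⟫ ⊎↔Fin+ ⟫ Fin-cong (sym (G-rec₁ m))
    count↔-by-gap (suc (suc k)) (suc (suc s)) s+k≡ =
      AvInv-rec₂ m s ⟫ ⊎-cong (ih₂ s) (count↔-by-gap k (4 + s) 4+s+k≡) ⟫ ⊎↔Fin+ ⟫ Fin-cong (sym (G-rec₂ m s))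
      where
      4+s+k≡ : 4 + s + k ≡ 4 + m
      4+s+k≡ = trans (cong (suc ∘ suc) (sym (trans (+-suc s (suc k)) (cong suc (+-suc s k))))) s+k≡

    count↔-2+m : ∀ s → AvInv (2 + m) s ↔ Fin (G (2 + m) s)
    count↔-2+m s = by-gap-or-above (s ≤? 4 + m)
      where
      by-gap-or-above : Dec (s ≤ 4 + m) → AvInv (2 + m) s ↔ Fin (G (2 + m) s)
      by-gap-or-above (yes s≤4+m) = count↔-by-gap (4 + m ∸ s) s (m+[n∸m]≡n s≤4+m)
      by-gap-or-above (no s≰4+m)  = above↔ (<-trans (n<1+n _) (<-trans (n<1+n _) (≰⇒> s≰4+m)))

  count↔ : ∀ n s → AvInv n s ↔ Fin (G n s)
  count↔ zero    zero    = AvInv-0-0↔ ⟫ Fin-cong (sym G-0-0)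
  count↔ zero    (suc s) = above↔ (s≤s z≤n)
  count↔ (suc L) zero    = empty↔ ¬AvInv-0 (G-suc-0 L)
  count↔ 1 1             = AvInv-1-1↔ ⟫ Fin-cong (sym G-1-1)
  count↔ 1 (suc (suc s)) = above↔ (s≤s (s≤s z≤n))
  count↔ (suc (suc m)) (suc s) = count↔-2+m m (count↔ (suc m) 1) (count↔ m) (suc s)

double : ℕ → ℕ
double zero    = 0
double (suc a) = suc (suc (double a))

double≡a+a : ∀ a → double a ≡ a + a
double≡a+a zero    = refl
double≡a+a (suc a) = cong suc (trans (cong suc (double≡a+a a)) (sym (+-suc a a)))

a≤double : ∀ a → a ≤ double a
a≤double a = subst (a ≤_) (sym (double≡a+a a)) (m≤m+n a a)

double∸a≡a : ∀ a → double a ∸ a ≡ a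
double∸a≡a a = trans (cong (_∸ a) (double≡a+a a)) (m+n∸n≡m a a)

double-mono-≤ : ∀ {a b} → a ≤ b → double a ≤ double b
double-mono-≤ z≤n       = z≤n
double-mono-≤ (s≤s a≤b) = s≤s (s≤s (double-mono-≤ a≤b))

double-cancel-≤ : ∀ {a b} → double a ≤ double b → a ≤ b
double-cancel-≤ {zero}              _                 = z≤n
double-cancel-≤ {suc a} {suc b} (s≤s (s≤s 2a≤2b)) = s≤s (double-cancel-≤ 2a≤2b)

data Parity : ℕ → Set where
  even : ∀ a → Parity (double a)
  odd  : ∀ a → Parity (suc (double a))

parity : ∀ n → Parity n
parity zero = even 0
parity (suc n) with parity n
... | even a = odd a
... | odd a  = even (suc a)

[2+n]/2≡1+n/2 : ∀ n → (2 + n) / 2 ≡ suc (n / 2)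
[2+n]/2≡1+n/2 n = m/n≡1+[m∸n]/n {2 + n} {2} (s≤s (s≤s z≤n))

[2+n]%2≡n%2 : ∀ n → (2 + n) % 2 ≡ n % 2
[2+n]%2≡n%2 n = trans (cong (_% 2) (+-comm 2 n)) ([m+n]%n≡m%n n 2)

double/2≡a : ∀ a → double a / 2 ≡ a
double/2≡a zero    = refl
double/2≡a (suc a) = trans ([2+n]/2≡1+n/2 (double a)) (cong suc (double/2≡a a))

[1+double]/2≡a : ∀ a → suc (double a) / 2 ≡ a
[1+double]/2≡a zero    = refl
[1+double]/2≡a (suc a) = trans ([2+n]/2≡1+n/2 (suc (double a))) (cong suc ([1+double]/2≡a a))

double%2≡0 : ∀ a → double a % 2 ≡ 0
double%2≡0 zero    = refl
double%2≡0 (suc a) = trans ([2+n]%2≡n%2 (double a)) (double%2≡0 a)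

[1+double]%2≡1 : ∀ a → suc (double a) % 2 ≡ 1
[1+double]%2≡1 zero    = refl
[1+double]%2≡1 (suc a) = trans ([2+n]%2≡n%2 (suc (double a))) ([1+double]%2≡1 a)

formula-odd : ∀ n t → formula n (suc (double t)) ≡ (n ∸ 1 ∸ t) C (n / 2)
formula-odd n t with even? (suc (double t))
... | yes ev = contradiction (trans (sym ([1+double]%2≡1 t)) ev) λ ()
... | no _   = cong (λ h → (n ∸ 1 ∸ h) C (n / 2)) (double/2≡a t)

formula-even : ∀ a t → formula (2 + double a) (2 + double t) ≡ (double a ∸ t) C a ∸ (double a ∸ t) C (suc a)
formula-even a t with even? (2 + double t)
... | no ¬ev = contradiction (double%2≡0 (suc t)) ¬ev
... | yes _ with even? (2 + double a)
...   | no ¬ev = contradiction (double%2≡0 (suc a)) ¬ev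
...   | yes _ rewrite double/2≡a (suc t) | double/2≡a (suc a) = refl

formula-odd-even : ∀ a t → formula (suc (double a)) (double t) ≡ 0
formula-odd-even a t with even? (double t)
... | no ¬ev = contradiction (double%2≡0 t) ¬ev
... | yes _ with even? (suc (double a))
...   | yes ev = contradiction (trans (sym ([1+double]%2≡1 a)) ev) λ ()
...   | no _   = refl

pascal : ∀ n k → suc n C suc k ≡ n C k + n C suc k
pascal n k = sym (nCk+nC[k+1]≡[n+1]C[k+1] n k)

central-C : ∀ k → suc (double k) C suc k ≡ suc (double k) C k
central-C k = begin
  suc (double k) C suc k                  ≡⟨ nCk≡nC[n∸k] (s≤s (a≤double k)) ⟩
  suc (double k) C (suc (double k) ∸ suc k) ≡⟨ cong (suc (double k) C_) (double∸a≡a k) ⟩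
  suc (double k) C k                      ∎
  where open ≡-Reasoning

C-antitone-past-middle : ∀ N k → N ≤ suc (double k) → N C suc k ≤ N C k
C-antitone-past-middle zero          k       _ = z≤n
C-antitone-past-middle (suc zero)    zero    _ = ≤-refl
C-antitone-past-middle (suc (suc N)) zero    (s≤s ())
C-antitone-past-middle (suc N)       (suc k) (s≤s N≤2+2k) with m≤n⇒m<n∨m≡n N≤2+2k
... | inj₁ N<2+2k = begin
  suc N C suc (suc k)       ≡⟨ pascal N (suc k) ⟩
  N C suc k + N C suc (suc k) ≤⟨ +-mono-≤ (C-antitone-past-middle N k (s≤s⁻¹ N<2+2k))
                                         (C-antitone-past-middle N (suc k) (m≤n⇒m≤1+n (m≤n⇒m≤1+n (s≤s⁻¹ N<2+2k)))) ⟩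
  N C k + N C suc k         ≡⟨ pascal N k ⟨
  suc N C suc k             ∎
  where open ≤-Reasoning
... | inj₂ refl = ≤-reflexive (central-C (suc k))

nCn∸nC[1+n]≡1 : ∀ n → n C n ∸ n C suc n ≡ 1
nCn∸nC[1+n]≡1 n rewrite nCn≡1 n | k>n⇒nCk≡0 (n<1+n n) = refl

count : ℕ → ℕ → ℕ
count zero    zero    = 1
count zero    (suc s) = 0
count (suc n) zero    = 0
count (suc n) (suc s) with s ≤? n
... | yes _ = formula (suc n) (suc s)
... | no _  = 0

count-formula : ∀ {n s} → s ≤ n → count (suc n) (suc s) ≡ formula (suc n) (suc s)
count-formula {n} {s} s≤n with s ≤? n
... | yes _   = refl
... | no s≰n  = contradiction s≤n s≰n

count-above : ∀ {n s} → n < s → count n s ≡ 0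
count-above {zero}  {suc s} _ = refl
count-above {suc n} {suc s} (s≤s n<s) with s ≤? n
... | yes s≤n = contradiction s≤n (<⇒≱ n<s)
... | no _    = refl

count-odd : ∀ {n t} → suc (double t) ≤ n → count n (suc (double t)) ≡ (n ∸ 1 ∸ t) C (n / 2)
count-odd {suc n} {t} (s≤s 2t≤n) = trans (count-formula 2t≤n) (formula-odd (suc n) t)

count-even : ∀ {a t} → t ≤ a → count (2 + double a) (2 + double t) ≡ (double a ∸ t) C a ∸ (double a ∸ t) C suc a
count-even {a} {t} t≤a = trans (count-formula (s≤s (double-mono-≤ t≤a))) (formula-even a t)

count-odd-even : ∀ a t → count (suc (double a)) (double t) ≡ 0
count-odd-even a zero    = refl
count-odd-even a (suc t) with suc (double t) ≤? double a
... | yes _ = formula-odd-even a (suc t)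
... | no _  = refl

count-rec₁ : ∀ m → count (2 + m) 1 ≡ count (1 + m) 1 + count (2 + m) 3
count-rec₁ m = begin
  count (2 + m) 1                            ≡⟨ count-odd {2 + m} {0} (s≤s z≤n) ⟩
  suc m C ((2 + m) / 2)                      ≡⟨ pascal-at-middle (parity m) ⟩
  m C ((1 + m) / 2) + m C ((2 + m) / 2)      ≡⟨ cong₂ _+_ (count-odd {1 + m} {0} (s≤s z≤n)) (count-3 m) ⟨
  count (1 + m) 1 + count (2 + m) 3          ∎
  where
  open ≡-Reasoning
  count-3 : ∀ m → count (2 + m) 3 ≡ m C ((2 + m) / 2)
  count-3 zero    = refl
  count-3 (suc m) = count-odd {3 + m} {1} (s≤s (s≤s (s≤s z≤n)))
  pascal-at-middle : ∀ {m} → Parity m → suc m C ((2 + m) / 2) ≡ m C ((1 + m) / 2) + m C ((2 + m) / 2)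
  pascal-at-middle (even a) rewrite double/2≡a (suc a) | [1+double]/2≡a a = pascal (double a) a
  pascal-at-middle (odd a) rewrite [1+double]/2≡a (suc a) | double/2≡a (suc a) =
    trans (pascal (suc (double a)) a) (cong (_+ suc (double a) C suc a) (sym (central-C a)))

[X+Y]∸[Y+Z]≡[X∸Y]+[Y∸Z] : ∀ {X Y Z} → Y ≤ X → Z ≤ Y → (X + Y) ∸ (Y + Z) ≡ (X ∸ Y) + (Y ∸ Z)
[X+Y]∸[Y+Z]≡[X∸Y]+[Y∸Z] {X} {Y} {Z} Y≤X Z≤Y = begin
  (X + Y) ∸ (Y + Z)   ≡⟨ cong (_∸ (Y + Z)) (+-comm X Y) ⟩
  (Y + X) ∸ (Y + Z)   ≡⟨ [m+n]∸[m+o]≡n∸o Y X Z ⟩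
  X ∸ Z               ≡⟨ cong (_∸ Z) (m∸n+n≡m Y≤X) ⟨
  (X ∸ Y) + Y ∸ Z     ≡⟨ +-∸-assoc (X ∸ Y) Z≤Y ⟩
  (X ∸ Y) + (Y ∸ Z)   ∎
  where open ≡-Reasoning

count-diagonal : ∀ a → count (2 + double a) (2 + double a) ≡ 1
count-diagonal a = begin
  count (2 + double a) (2 + double a)         ≡⟨ count-even {a} {a} ≤-refl ⟩
  (double a ∸ a) C a ∸ (double a ∸ a) C suc a ≡⟨ cong (λ N → N C a ∸ N C suc a) (double∸a≡a a) ⟩
  a C a ∸ a C suc a                           ≡⟨ nCn∸nC[1+n]≡1 a ⟩
  1                                           ∎
  where open ≡-Reasoning

count-2≡count-4 : ∀ a → count (2 + double (suc a)) 2 ≡ count (2 + double (suc a)) 4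
count-2≡count-4 a = begin
  count (2 + double (suc a)) 2                   ≡⟨ count-even {suc a} {0} z≤n ⟩
  (2 + double a) C suc a ∸ (2 + double a) C (2 + a) ≡⟨ cong₂ _∸_ (pascal (suc (double a)) a) (pascal (suc (double a)) (suc a)) ⟩
  (X + Y) ∸ (Y + Z)                              ≡⟨ cong (λ x → (x + Y) ∸ (Y + Z)) (sym (central-C a)) ⟩
  (Y + Y) ∸ (Y + Z)                              ≡⟨ [m+n]∸[m+o]≡n∸o Y Y Z ⟩
  Y ∸ Z                                          ≡⟨ count-even {suc a} {1} (s≤s z≤n) ⟨
  count (2 + double (suc a)) 4                   ∎
  where
  open ≡-Reasoning
  X = suc (double a) C a
  Y = suc (double a) C suc a
  Z = suc (double a) C (2 + a)

count-rec₂-even : ∀ a t → t ≤ a → count (2 + double a) (2 + double t) ≡ count (double a) (double t) + count (2 + double a) (4 + double t)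
count-rec₂-even zero    zero    _ = refl
count-rec₂-even (suc a) zero    _ = count-2≡count-4 a
count-rec₂-even (suc a) (suc t) (s≤s t≤a) with m≤n⇒m<n∨m≡n t≤a
... | inj₂ refl = begin
  count (2 + double (suc t)) (2 + double (suc t))  ≡⟨ count-diagonal (suc t) ⟩
  1                                                ≡⟨ count-diagonal t ⟨
  count (2 + double t) (2 + double t)              ≡⟨ +-identityʳ _ ⟨
  count (2 + double t) (2 + double t) + 0          ≡⟨ cong (count (2 + double t) (2 + double t) +_)
                                                        (count-above {2 + double (suc t)} {4 + double (suc t)} (m<n⇒m<1+n (n<1+n _))) ⟨
  count (2 + double t) (2 + double t) + count (2 + double (suc t)) (4 + double (suc t)) ∎
  where open ≡-Reasoning
... | inj₁ t<a = begin
  count (2 + double (suc a)) (2 + double (suc t))      ≡⟨ count-even {suc a} {suc t} (s≤s t≤a) ⟩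
  (suc (double a) ∸ t) C suc a ∸ (suc (double a) ∸ t) C (2 + a)
                                                       ≡⟨ cong (λ M → M C suc a ∸ M C (2 + a)) (+-∸-assoc 1 t≤2a) ⟩
  suc N C suc a ∸ suc N C (2 + a)                      ≡⟨ cong₂ _∸_ (pascal N a) (pascal N (suc a)) ⟩
  (X + Y) ∸ (Y + Z)                                    ≡⟨ [X+Y]∸[Y+Z]≡[X∸Y]+[Y∸Z] (C-antitone-past-middle N a N≤1+2a)
                                                            (C-antitone-past-middle N (suc a) (m≤n⇒m≤1+n (m≤n⇒m≤1+n N≤1+2a))) ⟩
  (X ∸ Y) + (Y ∸ Z)                                    ≡⟨ cong₂ _+_ (count-even {a} {t} t≤a) (count-even {suc a} {2 + t} (s≤s t<a)) ⟨
  count (2 + double a) (2 + double t) + count (2 + double (suc a)) (4 + double (suc t)) ∎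
  where
  open ≡-Reasoning
  N = double a ∸ t
  t≤2a = ≤-trans t≤a (a≤double a)
  N≤1+2a = m≤n⇒m≤1+n (m∸n≤m (double a) t)
  X = N C a
  Y = N C suc a
  Z = N C (2 + a)

[1+double]∸a≡1+a : ∀ a → suc (double a) ∸ a ≡ suc a
[1+double]∸a≡1+a a = trans (+-∸-assoc 1 (a≤double a)) (cong suc (double∸a≡a a))

count-rec₂-odd : ∀ m t → suc (double t) ≤ m →
  count (2 + m) (3 + double t) ≡ count m (suc (double t)) + count (2 + m) (5 + double t)
count-rec₂-odd (suc m) t (s≤s 2t≤m) = begin
  count (3 + m) (3 + double t)                  ≡⟨ count-odd {3 + m} {suc t} (s≤s (s≤s (s≤s 2t≤m))) ⟩
  (suc m ∸ t) C ((3 + m) / 2)                   ≡⟨ cong₂ _C_ (+-∸-assoc 1 t≤m) ([2+n]/2≡1+n/2 (suc m)) ⟩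
  suc (m ∸ t) C suc ((1 + m) / 2)               ≡⟨ pascal (m ∸ t) ((1 + m) / 2) ⟩
  (m ∸ t) C ((1 + m) / 2) + (m ∸ t) C suc ((1 + m) / 2)
                                                ≡⟨ cong₂ _+_ (count-odd {1 + m} {t} (s≤s 2t≤m)) tail ⟨
  count (1 + m) (suc (double t)) + count (3 + m) (5 + double t) ∎
  where
  open ≡-Reasoning
  t≤m = ≤-trans (a≤double t) 2t≤m
  tail : count (3 + m) (5 + double t) ≡ (m ∸ t) C suc ((1 + m) / 2)
  tail with 2 + double t ≤? m
  ... | yes 2+2t≤m = trans (count-odd {3 + m} {2 + t} (s≤s (s≤s (s≤s 2+2t≤m)))) (cong ((m ∸ t) C_) ([2+n]/2≡1+n/2 (suc m)))
  ... | no 2+2t≰m with m≤n⇒m<n∨m≡n 2t≤m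
  ...   | inj₂ refl = trans (count-above {3 + double t} {5 + double t} (<-trans (n<1+n _) (n<1+n _)))
                        (sym (k>n⇒nCk≡0 (s≤s (≤-reflexive (trans (double∸a≡a t) (sym ([1+double]/2≡a t)))))))
  ...   | inj₁ 2t<m with ≤-antisym 2t<m (≮⇒≥ 2+2t≰m)
  ...     | refl = trans (count-above {4 + double t} {5 + double t} (n<1+n _))
                     (sym (k>n⇒nCk≡0 (s≤s (≤-reflexive (trans ([1+double]∸a≡1+a t) (sym (double/2≡a (suc t))))))))

count-rec₂ : ∀ m s → count (2 + m) (2 + s) ≡ count m s + count (2 + m) (4 + s)
count-rec₂ m s with s ≤? m
... | yes s≤m = by-parity (parity m) (parity s) s≤m
  where
  by-parity : ∀ {m s} → Parity m → Parity s → s ≤ m → count (2 + m) (2 + s) ≡ count m s + count (2 + m) (4 + s)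
  by-parity (even a) (even t) 2t≤2a = count-rec₂-even a t (double-cancel-≤ 2t≤2a)
  by-parity (odd a)  (even t) _     =
    trans (count-odd-even (suc a) (suc t)) (sym (cong₂ _+_ (count-odd-even a t) (count-odd-even (suc a) (2 + t))))
  by-parity {m} (even _) (odd t) 1+2t≤m = count-rec₂-odd m t 1+2t≤m
  by-parity {m} (odd _)  (odd t) 1+2t≤m = count-rec₂-odd m t 1+2t≤m
... | no s≰m = begin
  count (2 + m) (2 + s)                    ≡⟨ count-above (s≤s (s≤s m<s)) ⟩
  0                                        ≡⟨ cong₂ _+_ (count-above m<s) (count-above (s≤s (s≤s (m<n⇒m<1+n (m<n⇒m<1+n m<s))))) ⟨
  count m s + count (2 + m) (4 + s)        ∎
  where
  open ≡-Reasoning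
  m<s = ≰⇒> s≰m

count≡formula : ∀ n s → 1 ≤ s → s ≤ n → count n s ≡ formula n s
count≡formula (suc n) (suc s) _ (s≤s s≤n) = count-formula s≤n

theorem4p4 : (n s : ℕ) → 1 ≤ n → 1 ≤ s → s ≤ n →
    (Σ[ π ∈ Word n ] (True (isPerm? π) × True (isInvolution? π) × True (avoids132? π) × rlmax π ≡ s))
    ↔ Fin (formula n s)
theorem4p4 n s _ 1≤s s≤n = count↔ n s ⟫ Fin-cong (count≡formula n s 1≤s s≤n)
  where open Counting count refl refl (λ _ → refl) (λ _ _ → count-above) count-rec₁ count-rec₂
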